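{- Let $n\ge 1$ and let $H(n)$ denote the number of convex hexagons in an $n$-triangular net. Then \[ H(n)=\begin{cases} \frac{1}{60}\left(8k^6+24k^5+25k^4+10k^3-3k^2-4k\right), & n=2k+1\ (k=0,1,2,\dots),\\[2pt] \frac{1}{60}\left(8k^6-5k^4-3k^2\right), & n=2k\ (k=1,2,\dots).\end{cases} \]
   Context: An $n$-triangular net ($n\ge 1$) is obtained from a triangle by dividing each of its three edges into $n$ equal parts and then, for each pair of edges, drawing the $n-1$ segments joining corresponding dividing points on those two edges parallel to the third edge. (For $n=1$ it is just the triangle.) The net thus consists of the three edges of the triangle together with these segments; all line segments of the net lie on lines parallel to one of the three sides. A convex hexagon in the net is a convex polygon with exactly six vertices (each interior angle strictly less than $\pi$) whose sides all lie on segments of the net (so its vertices are intersection points of the net). The count depends only on $n$, not on the shape or size of the triangle. -}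

module Defs where

open import Data.Nat as ℕ using (ℕ; zero; suc; _∸_)
open import Data.Nat.DivMod using (_/_)
open import Data.Integer as ℤ using (ℤ; +_)
open import Data.Bool using (Bool; _∧_; _∨_; T)
open import Data.Fin using (Fin; zero; suc)
open import Data.Product using (_×_; _,_)
open import Data.List using (List; []; _∷_; map; concatMap; upTo; allFin; length; filter)
open import Data.Bool.ListAction using (and)
open import Data.Vec using (Vec; []; _∷_; lookup)
open import Relation.Nullary.Decidable using (⌊_⌋; T?)

-- A point of the n-triangular net is given by barycentric-type integer
-- coordinates (a , b) with a + b ≤ n (the third coordinate is c = n - a - b).
-- This is an affine image of the triangle; net lines are a = i, b = j,
-- a + b = const (i.e. c = k).  Counting is affine invariant.
Point : Set
Point = ℕ × ℕ

netPoints : ℕ → List Point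
netPoints n = concatMap (λ a → map (λ b → (a , b)) (upTo (suc (n ∸ a)))) (upTo (suc n))

-- p and q lie on a common line of the net (a common net segment joins them,
-- since every net line meets the triangle in a single full chord)
onNetLine : Point → Point → Bool
onNetLine (a , b) (a' , b') =
  ⌊ a ℕ.≟ a' ⌋ ∨ ⌊ b ℕ.≟ b' ⌋ ∨ ⌊ (a ℕ.+ b) ℕ.≟ (a' ℕ.+ b') ⌋

cross : Point → Point → Point → ℤ
cross (a₀ , b₀) (a₁ , b₁) (a₂ , b₂) =
  ((+ a₁ ℤ.- + a₀) ℤ.* (+ b₂ ℤ.- + b₀)) ℤ.- ((+ b₁ ℤ.- + b₀) ℤ.* (+ a₂ ℤ.- + a₀))

strictlyLeft : Point → Point → Point → Bool
strictlyLeft o p q = ⌊ ℤ.+0 ℤ.<? cross o p q ⌋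

nxt : Fin 6 → Fin 6
nxt zero = suc zero
nxt (suc zero) = suc (suc zero)
nxt (suc (suc zero)) = suc (suc (suc zero))
nxt (suc (suc (suc zero))) = suc (suc (suc (suc zero)))
nxt (suc (suc (suc (suc zero)))) = suc (suc (suc (suc (suc zero))))
nxt (suc (suc (suc (suc (suc zero))))) = zero

isEndpoint : Fin 6 → Fin 6 → Bool
isEndpoint i j = ⌊ j Data.Fin.≟ i ⌋ ∨ ⌊ j Data.Fin.≟ nxt i ⌋

-- v₀,…,v₅ (net points) are the counterclockwise-listed vertices of a convex
-- hexagon whose sides lie on the net: each side vᵢvᵢ₊₁ lies on a net line,
-- and every other vertex lies strictly on the inner (left) side of the line
-- through each side.  This is exactly strict convexity with six genuine
-- vertices (interior angles < π, vertices distinct, simple polygon).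
isNetHexagon : Vec Point 6 → Bool
isNetHexagon v =
  and (map (λ i → onNetLine (lookup v i) (lookup v (nxt i))
           ∧ and (map (λ j → isEndpoint i j ∨ strictlyLeft (lookup v i) (lookup v (nxt i)) (lookup v j))
                      (allFin 6)))
           (allFin 6))

tuples : (k : ℕ) → {A : Set} → List A → List (Vec A k)
tuples zero xs = [] ∷ []
tuples (suc k) xs = concatMap (λ x → map (x ∷_) (tuples k xs)) xs

hexLabellings : ℕ → ℕ
hexLabellings n = length (filter (λ v → T? (isNetHexagon v)) (tuples 6 (netPoints n)))

-- H(n): each hexagon has exactly 6 counterclockwise labellings (choice of v₀)
H : ℕ → ℕ
H n = hexLabellings n / 6

module Submission where

-- A labelling v₀ … v₅ passes `isNetHexagon` exactly when it is a regular path: its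
-- sides point, in order, in the six net directions d, d + 60°, …, d + 300°.  Indeed every exterior
-- turn of a convex net polygon is 60° or 120°, the six turns add up to a multiple of 360°, and six
-- turns of 120° would make two opposite sides parallel and equally oriented.  A regular path starting in direction 0 is an upward triangle of side k + 2 with
-- lower-left corner (p , q), cut at its corners by triangles of sides x + 1, y + 1, z + 1, where
-- x + y, y + z, x + z < k; it lies in the net iff r + q + p + (k + 2) = n for some r.  So each
-- hexagon has exactly six labellings, one per initial direction, and H(n) is the number of such
-- placements (r , q , p , k , x , y , z).  Listing placements by their slacks r, q, p shows that their number is the third running
-- total of the number of shapes (x , y , z); that number is a cubic quasi-polynomial of period 2,
-- so the running totals are quasi-polynomials too, and the ring solver checks the closed forms.

open import Defs
open import Data.Nat using (ℕ; zero; suc; _+_; _*_; _^_; _∸_; _≤_; _<_; z≤n; s≤s)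
import Data.Nat.Properties as ℕ
open import Data.Nat.DivMod using (_/_; m*n/n≡m)
open import Data.Nat.Tactic.RingSolver using (solve-∀)
open import Data.Integer as ℤ using (ℤ; +_; +<+)
import Data.Integer.Properties as ℤ
open import Data.Integer.Tactic.RingSolver using () renaming (solve-∀ to ℤ-solve-∀)
open import Data.Bool using (Bool; true; false; T; _∧_; _∨_)
open import Data.Bool.ListAction using (and)
open import Data.Unit using (tt)
open import Data.Empty using (⊥; ⊥-elim)
open import Data.Product using (_×_; _,_; Σ; proj₁; proj₂; map₁)
open import Data.Sum using (_⊎_; inj₁; inj₂; [_,_]′)
open import Data.Fin using (Fin; #_)
open import Data.Vec using (Vec; []; _∷_; lookup)
open import Data.Vec.Properties using (∷-injectiveˡ; ∷-injectiveʳ)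
import Data.Vec.Relation.Unary.All as VecAll
open import Data.List using (List; []; _∷_; map; _++_; length; upTo; allFin; filter; concatMap; cartesianProduct)
open import Data.List.Properties using (length-map; length-++; length-upTo)
open import Data.List.Membership.Propositional using (_∈_; find; lose)
open import Data.List.Membership.Propositional.Properties
  using (∈-map⁺; ∈-map⁻; ∈-++⁺ˡ; ∈-++⁺ʳ; ∈-++⁻; ∈-upTo⁺; ∈-upTo⁻; ∈-allFin; ∈-filter⁺; ∈-filter⁻;
         ∈-concatMap⁺; ∈-concatMap⁻; ∈-cartesianProduct⁺; ∈-cartesianProduct⁻)
open import Data.List.Membership.Propositional.Properties.WithK using (unique∧set⇒bag)
open import Data.List.Relation.Unary.Any using (here; there)
open import Data.List.Relation.Unary.All using (All; []; _∷_)
import Data.List.Relation.Unary.All as All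
import Data.List.Relation.Unary.All.Properties as All
open import Data.List.Relation.Unary.AllPairs using ([]; _∷_)
open import Data.List.Relation.Unary.Unique.Propositional using (Unique)
import Data.List.Relation.Unary.Unique.Propositional.Properties as Unique
open import Data.List.Relation.Binary.Disjoint.Propositional using (Disjoint)
open import Data.List.Relation.Binary.BagAndSetEquality using (∼bag⇒↭)
open import Data.List.Relation.Binary.Permutation.Propositional.Properties using (↭-length)
open import Function using (_∘_)
open import Function.Bundles using (_⇔_; mk⇔)
open import Relation.Binary using (tri<; tri≈; tri>)
open import Relation.Binary.PropositionalEquality
open import Relation.Nullary using (yes; no)
open import Relation.Nullary.Decidable using (toWitness; fromWitness; T?)
open import Relation.Unary using (Decidable)

disjoint-map : {A B C : Set} {f : A → C} {g : B → C} {xs : List A} {ys : List B} →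
               (∀ {a b} → f a ≢ g b) → Disjoint (map f xs) (map g ys)
disjoint-map {f = f} {g} f≢g (p , q) with ∈-map⁻ f p | ∈-map⁻ g q
... | _ , _ , refl | _ , _ , fa≡gb = f≢g fa≡gb

disjoint-++ : {A : Set} {xs zs : List A} (ys : List A) → Disjoint xs ys → Disjoint xs zs → Disjoint xs (ys ++ zs)
disjoint-++ ys d e (p , q) with ∈-++⁻ ys q
... | inj₁ q = d (p , q)
... | inj₂ q = e (p , q)

map-unique : ∀ {A B : Set} (f : A → B) {xs} → Unique xs →
             (∀ {x y} → x ∈ xs → y ∈ xs → f x ≡ f y → x ≡ y) → Unique (map f xs)
map-unique f {[]}     _            _   = []
map-unique f {x ∷ xs} (x∉xs ∷ uxs) inj =
  All.tabulate (λ {w} w∈ fx≡w → let y , y∈ , w≡fy = ∈-map⁻ f w∈ in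
                                All.lookup x∉xs y∈ (inj (here refl) (there y∈) (trans fx≡w w≡fy)))
  ∷ map-unique f uxs (λ x∈ y∈ → inj (there x∈) (there y∈))

concatMap-unique : ∀ {A B : Set} (f : A → List B) {xs} → Unique xs → (∀ x → Unique (f x)) →
                   (∀ {x y} → x ≢ y → Disjoint (f x) (f y)) → Unique (concatMap f xs)
concatMap-unique f {[]}     _            _  _        = []
concatMap-unique f {x ∷ xs} (x∉xs ∷ uxs) uf disjoint =
  Unique.++⁺ (uf x) (concatMap-unique f uxs uf disjoint)
    (λ (v∈fx , v∈rest) → let y , y∈ , v∈fy = find (∈-concatMap⁻ f {xs = xs} v∈rest) in
                         disjoint (All.lookup x∉xs y∈) (v∈fx , v∈fy))

length-map-++ : {A B : Set} (f : A → B) (xs : List A) (ys : List B) → length (map f xs ++ ys) ≡ length xs + length ys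
length-map-++ f xs ys = trans (length-++ (map f xs)) (cong (_+ length ys) (length-map f xs))

length-cartesianProduct : ∀ {A B : Set} (xs : List A) (ys : List B) →
                          length (cartesianProduct xs ys) ≡ length xs * length ys
length-cartesianProduct []       ys = refl
length-cartesianProduct (x ∷ xs) ys =
  trans (length-++ (map (x ,_) ys)) (cong₂ _+_ (length-map (x ,_) ys) (length-cartesianProduct xs ys))

same-length : ∀ {A : Set} {xs ys : List A} → Unique xs → Unique ys → (∀ {v} → v ∈ xs ⇔ v ∈ ys) →
              length xs ≡ length ys
same-length uxs uys same = ↭-length (∼bag⇒↭ (unique∧set⇒bag uxs uys same))

total : (ℕ → ℕ) → ℕ → ℕ
total f zero    = f zero
total f (suc n) = total f n + f (suc n)

total-cong : ∀ {f g : ℕ → ℕ} → (∀ n → f n ≡ g n) → ∀ n → total f n ≡ total g n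
total-cong f≡g zero    = f≡g zero
total-cong f≡g (suc n) = cong₂ _+_ (total-cong f≡g n) (f≡g (suc n))

-- withSlack F n lists the pairs (s , a) with a ∈ F m and s + m = n: objects of any size m ≤ n,
-- each tagged with the slack s = n - m.
tight : {A : Set} → A → ℕ × A
tight a = 0 , a

loosen : {A : Set} → ℕ × A → ℕ × A
loosen = map₁ suc

withSlack : {A : Set} → (ℕ → List A) → ℕ → List (ℕ × A)
withSlack F zero    = map tight (F zero)
withSlack F (suc n) = map loosen (withSlack F n) ++ map tight (F (suc n))

module _ {A : Set} {F : ℕ → List A} where

  ∈-withSlack⁺ : ∀ {m a} s → a ∈ F m → (s , a) ∈ withSlack F (s + m)
  ∈-withSlack⁺ {zero}  zero    a∈ = ∈-map⁺ tight a∈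
  ∈-withSlack⁺ {suc m} zero    a∈ = ∈-++⁺ʳ (map loosen (withSlack F m)) (∈-map⁺ tight a∈)
  ∈-withSlack⁺         (suc s) a∈ = ∈-++⁺ˡ (∈-map⁺ loosen (∈-withSlack⁺ s a∈))

  ∈-withSlack⁻ : ∀ n {s a} → (s , a) ∈ withSlack F n → Σ ℕ λ m → s + m ≡ n × a ∈ F m
  ∈-withSlack⁻ zero p with ∈-map⁻ tight p
  ... | _ , a∈ , refl = 0 , refl , a∈
  ∈-withSlack⁻ (suc n) p with ∈-++⁻ (map loosen (withSlack F n)) p
  ... | inj₂ q with ∈-map⁻ tight q
  ...   | _ , a∈ , refl = suc n , refl , a∈
  ∈-withSlack⁻ (suc n) p | inj₁ q with ∈-map⁻ loosen q
  ...   | _ , r , refl with ∈-withSlack⁻ n r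
  ...     | m , s+m≡n , a∈ = m , cong suc s+m≡n , a∈

  -- the two parts of each step are told apart by the slack: positive versus 0
  withSlack-unique : (∀ m → Unique (F m)) → ∀ n → Unique (withSlack F n)
  withSlack-unique uF zero    = Unique.map⁺ (λ { refl → refl }) (uF zero)
  withSlack-unique uF (suc n) =
    Unique.++⁺ (Unique.map⁺ (λ { {_ , _} {_ , _} refl → refl }) (withSlack-unique uF n))
               (Unique.map⁺ (λ { refl → refl }) (uF (suc n)))
               (disjoint-map λ ())

  length-withSlack : ∀ n → length (withSlack F n) ≡ total (λ m → length (F m)) n
  length-withSlack zero    = length-map tight (F zero)
  length-withSlack (suc n) = begin
    length (map loosen (withSlack F n) ++ map tight (F (suc n)))
      ≡⟨ length-map-++ loosen (withSlack F n) (map tight (F (suc n))) ⟩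
    length (withSlack F n) + length (map tight (F (suc n)))
      ≡⟨ cong₂ _+_ (length-withSlack n) (length-map tight (F (suc n))) ⟩
    total (λ m → length (F m)) n + length (F (suc n)) ∎
    where open ≡-Reasoning

-- A hexagon whose bounding upward triangle has side k + 2 is that triangle with its three
-- corners cut off by triangles of sides x + 1, y + 1, z + 1; the remaining three sides have
-- positive length exactly when x + y, y + z and x + z are less than k.
Shape : Set
Shape = ℕ × ℕ × ℕ

IsShape : ℕ → Shape → Set
IsShape k (x , y , z) = x + y < k × y + z < k × x + z < k

below : ℕ → List (ℕ × ℕ)
below zero    = []
below (suc k) = withSlack (λ m → upTo (suc m)) k

∈-below⁺ : ∀ {k u v} → u + v < k → (u , v) ∈ below k
∈-below⁺ {suc k} {u} {v} u+v<1+k =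
  subst (λ n → (u , v) ∈ withSlack _ n) (trans (sym (ℕ.+-assoc u v e)) (ℕ.m+[n∸m]≡n (ℕ.≤-pred u+v<1+k)))
        (∈-withSlack⁺ u (∈-upTo⁺ (s≤s (ℕ.m≤m+n v e))))
  where e = k ∸ (u + v)

∈-below⁻ : ∀ {k u v} → (u , v) ∈ below k → u + v < k
∈-below⁻ {suc k} {u} {v} p with ∈-withSlack⁻ k p
... | m , u+m≡k , v∈ = s≤s (subst (u + v ≤_) u+m≡k (ℕ.+-monoʳ-≤ u (ℕ.≤-pred (∈-upTo⁻ v∈))))

below-unique : ∀ k → Unique (below k)
below-unique zero    = []
below-unique (suc k) = withSlack-unique (λ m → Unique.upTo⁺ (suc m)) k

triangular : ∀ k → 60 * total suc k ≡ 30 * (suc k * suc k + suc k)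
triangular zero    = refl
triangular (suc k) = begin
  60 * (total suc k + suc (suc k))                  ≡⟨ ℕ.*-distribˡ-+ 60 (total suc k) _ ⟩
  60 * total suc k + 60 * suc (suc k)               ≡⟨ cong (_+ 60 * suc (suc k)) (triangular k) ⟩
  30 * (suc k * suc k + suc k) + 60 * suc (suc k)   ≡⟨ step k ⟩
  30 * (suc (suc k) * suc (suc k) + suc (suc k))    ∎
  where
  open ≡-Reasoning
  step : ∀ k → 30 * (suc k * suc k + suc k) + 60 * suc (suc k) ≡ 30 * (suc (suc k) * suc (suc k) + suc (suc k))
  step = solve-∀

length-below : ∀ k → 60 * length (below k) ≡ 30 * (k * k + k)
length-below zero    = refl
length-below (suc k) = begin
  60 * length (below (suc k))                ≡⟨ cong (60 *_) (length-withSlack k) ⟩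
  60 * total (λ m → length (upTo (suc m))) k ≡⟨ cong (60 *_) (total-cong (λ m → length-upTo (suc m)) k) ⟩
  60 * total suc k                           ≡⟨ triangular k ⟩
  30 * (suc k * suc k + suc k)               ∎
  where open ≡-Reasoning

-- The shapes of index k + 2 are the shapes of index k with every cut enlarged by one (grow),
-- together with those having a cut of size 1: at the first corner (cornerX), else at the second
-- (cornerY), else at the third (cornerZ).  The four parts differ in the pattern of zero cuts.
grow : Shape → Shape
grow (x , y , z) = suc x , suc y , suc z

cornerX : ℕ × ℕ → Shape
cornerX (y , z) = 0 , y , z

cornerY : ℕ × ℕ → Shape
cornerY (x , z) = suc x , 0 , z

cornerZ : ℕ × ℕ → Shape
cornerZ (x , y) = suc x , suc y , 0

shapes : ℕ → List Shape
shapes zero          = []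
shapes (suc zero)    = (0 , 0 , 0) ∷ []
shapes (suc (suc k)) =
  map grow (shapes k) ++ (map cornerX (below (2 + k)) ++ (map cornerY (below (1 + k)) ++ map cornerZ (below k)))

grow< : ∀ {x y k} → x + y < k → suc x + suc y < 2 + k
grow< {x} {y} {k} x+y<k = s≤s (subst (λ t → suc t ≤ suc k) (sym (ℕ.+-suc x y)) (s≤s x+y<k))

shrink< : ∀ {x y k} → suc x + suc y < 2 + k → x + y < k
shrink< {x} {y} {k} h = ℕ.≤-pred (subst (λ t → suc t ≤ suc k) (ℕ.+-suc x y) (ℕ.≤-pred h))

summand₁< : ∀ {x y k} → x + y < k → x < k
summand₁< {x} {y} x+y<k = ℕ.≤-trans (s≤s (ℕ.m≤m+n x y)) x+y<k

summand₂< : ∀ {x y k} → x + y < k → y < k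
summand₂< {x} {y} x+y<k = ℕ.≤-trans (s≤s (ℕ.m≤n+m y x)) x+y<k

+0< : ∀ {x k} → x < k → x + 0 < k
+0< {x} = subst (_< _) (sym (ℕ.+-identityʳ x))

∈-shapes⁻ : ∀ k {s} → s ∈ shapes k → IsShape k s
∈-shapes⁻ (suc zero) (here refl) = s≤s z≤n , s≤s z≤n , s≤s z≤n
∈-shapes⁻ (suc (suc k)) p with ∈-++⁻ (map grow (shapes k)) p
... | inj₁ q with ∈-map⁻ grow q
...   | _ , r , refl with ∈-shapes⁻ k r
...     | xy , yz , xz = grow< xy , grow< yz , grow< xz
∈-shapes⁻ (suc (suc k)) p | inj₂ p′ with ∈-++⁻ (map cornerX (below (2 + k))) p′
... | inj₁ q with ∈-map⁻ cornerX q
...   | _ , r , refl = let yz = ∈-below⁻ r in summand₁< yz , yz , summand₂< yz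
∈-shapes⁻ (suc (suc k)) p | inj₂ p′ | inj₂ p″ with ∈-++⁻ (map cornerY (below (1 + k))) p″
... | inj₁ q with ∈-map⁻ cornerY q
...   | _ , r , refl = let xz = ∈-below⁻ r in s≤s (+0< (summand₁< xz)) , ℕ.m<n⇒m<1+n (summand₂< xz) , s≤s xz
∈-shapes⁻ (suc (suc k)) p | inj₂ p′ | inj₂ p″ | inj₂ q with ∈-map⁻ cornerZ q
...   | _ , r , refl = let xy = ∈-below⁻ r
                       in grow< xy , s≤s (+0< (ℕ.m<n⇒m<1+n (summand₂< xy))) , s≤s (+0< (ℕ.m<n⇒m<1+n (summand₁< xy)))

∈-shapes⁺ : ∀ k {s} → IsShape k s → s ∈ shapes k
∈-shapes⁺ (suc zero) {zero , zero , zero} _ = here refl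
∈-shapes⁺ (suc zero) {suc x , _ , _} (s≤s () , _)
∈-shapes⁺ (suc zero) {zero , suc y , _} (s≤s () , _)
∈-shapes⁺ (suc zero) {zero , zero , suc z} (_ , s≤s () , _)
∈-shapes⁺ (suc (suc k)) {zero , y , z} (_ , yz , _) =
  ∈-++⁺ʳ (map grow (shapes k)) (∈-++⁺ˡ (∈-map⁺ cornerX (∈-below⁺ yz)))
∈-shapes⁺ (suc (suc k)) {suc x , zero , z} (_ , _ , xz) =
  ∈-++⁺ʳ (map grow (shapes k)) (∈-++⁺ʳ (map cornerX (below (2 + k)))
    (∈-++⁺ˡ (∈-map⁺ cornerY (∈-below⁺ (ℕ.≤-pred xz)))))
∈-shapes⁺ (suc (suc k)) {suc x , suc y , zero} (xy , _ , _) =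
  ∈-++⁺ʳ (map grow (shapes k)) (∈-++⁺ʳ (map cornerX (below (2 + k)))
    (∈-++⁺ʳ (map cornerY (below (1 + k))) (∈-map⁺ cornerZ (∈-below⁺ (shrink< xy)))))
∈-shapes⁺ (suc (suc k)) {suc x , suc y , suc z} (xy , yz , xz) =
  ∈-++⁺ˡ (∈-map⁺ grow (∈-shapes⁺ k (shrink< xy , shrink< yz , shrink< xz)))

shapes-unique : ∀ k → Unique (shapes k)
shapes-unique zero          = []
shapes-unique (suc zero)    = All.[] ∷ []
shapes-unique (suc (suc k)) =
  Unique.++⁺ (Unique.map⁺ (λ { {_ , _ , _} {_ , _ , _} refl → refl }) (shapes-unique k))
    (Unique.++⁺ (Unique.map⁺ (λ { {_ , _} {_ , _} refl → refl }) (below-unique (2 + k)))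
      (Unique.++⁺ (Unique.map⁺ (λ { {_ , _} {_ , _} refl → refl }) (below-unique (1 + k)))
                  (Unique.map⁺ (λ { {_ , _} {_ , _} refl → refl }) (below-unique k))
                  (disjoint-map {f = cornerY} {g = cornerZ} λ ()))
      (disjoint-++ (map cornerY (below (1 + k))) (disjoint-map {f = cornerX} {g = cornerY} λ ())
                   (disjoint-map {f = cornerX} {g = cornerZ} λ ())))
    (disjoint-++ (map cornerX (below (2 + k))) (disjoint-map {f = grow} {g = cornerX} λ ())
      (disjoint-++ (map cornerY (below (1 + k))) (disjoint-map {f = grow} {g = cornerY} λ ())
                   (disjoint-map {f = grow} {g = cornerZ} λ ())))

#shapes : ℕ → ℕ
#shapes k = length (shapes k)

#shapes-parts : ∀ k → #shapes (2 + k) ≡ #shapes k + (length (below (2 + k)) + (length (below (1 + k)) + length (below k)))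
#shapes-parts k =
  trans (length-map-++ grow (shapes k) _)
        (cong (λ t → #shapes k + t) (trans (length-map-++ cornerX (below (2 + k)) _)
          (cong (λ t → length (below (2 + k)) + t) (trans (length-map-++ cornerY (below (1 + k)) _)
            (cong (λ t → length (below (1 + k)) + t) (length-map cornerZ (below k)))))))

#shapes-step : ∀ k → 60 * #shapes (2 + k) ≡ 60 * #shapes k + 30 * (3 * (k * k) + 9 * k + 8)
#shapes-step k = begin
  60 * #shapes (2 + k)
    ≡⟨ cong (60 *_) (#shapes-parts k) ⟩
  60 * (#shapes k + (length (below (2 + k)) + (length (below (1 + k)) + length (below k))))
    ≡⟨ distrib (#shapes k) (length (below (2 + k))) (length (below (1 + k))) (length (below k)) ⟩
  60 * #shapes k + (60 * length (below (2 + k)) + (60 * length (below (1 + k)) + 60 * length (below k)))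
    ≡⟨ cong (λ t → 60 * #shapes k + t) (cong₂ _+_ (length-below (2 + k)) (cong₂ _+_ (length-below (1 + k)) (length-below k))) ⟩
  60 * #shapes k + (30 * ((2 + k) * (2 + k) + (2 + k)) + (30 * ((1 + k) * (1 + k) + (1 + k)) + 30 * (k * k + k)))
    ≡⟨ cong (λ t → 60 * #shapes k + t) (poly k) ⟩
  60 * #shapes k + 30 * (3 * (k * k) + 9 * k + 8) ∎
  where
  open ≡-Reasoning
  distrib : ∀ a b c d → 60 * (a + (b + (c + d))) ≡ 60 * a + (60 * b + (60 * c + 60 * d))
  distrib = solve-∀
  poly : ∀ k → 30 * ((2 + k) * (2 + k) + (2 + k)) + (30 * ((1 + k) * (1 + k) + (1 + k)) + 30 * (k * k + k))
             ≡ 30 * (3 * (k * k) + 9 * k + 8)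
  poly = solve-∀

#shapes-even : ∀ j → 60 * #shapes (2 * j) ≡ 120 * (j * j * j) + 90 * (j * j) + 30 * j
#shapes-even zero    = refl
#shapes-even (suc j) = begin
  60 * #shapes (2 * suc j)                ≡⟨ cong (λ n → 60 * #shapes n) (ℕ.*-suc 2 j) ⟩
  60 * #shapes (2 + 2 * j)                ≡⟨ #shapes-step (2 * j) ⟩
  60 * #shapes (2 * j) + 30 * (3 * (2 * j * (2 * j)) + 9 * (2 * j) + 8)
                                          ≡⟨ cong (_+ 30 * (3 * (2 * j * (2 * j)) + 9 * (2 * j) + 8)) (#shapes-even j) ⟩
  120 * (j * j * j) + 90 * (j * j) + 30 * j + 30 * (3 * (2 * j * (2 * j)) + 9 * (2 * j) + 8)
                                          ≡⟨ poly j ⟩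
  120 * (suc j * suc j * suc j) + 90 * (suc j * suc j) + 30 * suc j ∎
  where
  open ≡-Reasoning
  poly : ∀ j → 120 * (j * j * j) + 90 * (j * j) + 30 * j + 30 * (3 * (2 * j * (2 * j)) + 9 * (2 * j) + 8)
             ≡ 120 * (suc j * suc j * suc j) + 90 * (suc j * suc j) + 30 * suc j
  poly = solve-∀

#shapes-odd : ∀ j → 60 * #shapes (1 + 2 * j) ≡ 120 * (j * j * j) + 270 * (j * j) + 210 * j + 60
#shapes-odd zero    = refl
#shapes-odd (suc j) = begin
  60 * #shapes (1 + 2 * suc j)            ≡⟨ cong (λ n → 60 * #shapes (1 + n)) (ℕ.*-suc 2 j) ⟩
  60 * #shapes (2 + (1 + 2 * j))          ≡⟨ #shapes-step (1 + 2 * j) ⟩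
  60 * #shapes (1 + 2 * j) + 30 * (3 * ((1 + 2 * j) * (1 + 2 * j)) + 9 * (1 + 2 * j) + 8)
                                          ≡⟨ cong (_+ 30 * (3 * ((1 + 2 * j) * (1 + 2 * j)) + 9 * (1 + 2 * j) + 8)) (#shapes-odd j) ⟩
  120 * (j * j * j) + 270 * (j * j) + 210 * j + 60 + 30 * (3 * ((1 + 2 * j) * (1 + 2 * j)) + 9 * (1 + 2 * j) + 8)
                                          ≡⟨ poly j ⟩
  120 * (suc j * suc j * suc j) + 270 * (suc j * suc j) + 210 * suc j + 60 ∎
  where
  open ≡-Reasoning
  poly : ∀ j → 120 * (j * j * j) + 270 * (j * j) + 210 * j + 60 + 30 * (3 * ((1 + 2 * j) * (1 + 2 * j)) + 9 * (1 + 2 * j) + 8)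
             ≡ 120 * (suc j * suc j * suc j) + 270 * (suc j * suc j) + 210 * suc j + 60
  poly = solve-∀

total-parity : ∀ c (f : ℕ → ℕ) (Fe Fo Ge Go : ℕ → ℕ) →
  (∀ j → c * f (2 * j) ≡ Fe j) → (∀ j → c * f (1 + 2 * j) ≡ Fo j) →
  Ge 0 ≡ Fe 0 → (∀ j → Go j ≡ Ge j + Fo j) → (∀ j → Ge (suc j) ≡ Go j + Fe (suc j)) →
  ∀ j → c * total f (2 * j) ≡ Ge j × c * total f (1 + 2 * j) ≡ Go j
total-parity c f Fe Fo Ge Go f-even f-odd base odd-step even-step = both
  where
  open ≡-Reasoning
  atOdd : ∀ j → c * total f (2 * j) ≡ Ge j → c * total f (1 + 2 * j) ≡ Go j
  atOdd j e = begin
    c * (total f (2 * j) + f (1 + 2 * j))      ≡⟨ ℕ.*-distribˡ-+ c (total f (2 * j)) _ ⟩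
    c * total f (2 * j) + c * f (1 + 2 * j)    ≡⟨ cong₂ _+_ e (f-odd j) ⟩
    Ge j + Fo j                                ≡⟨ sym (odd-step j) ⟩
    Go j                                       ∎
  atEven : ∀ j → c * total f (1 + 2 * j) ≡ Go j → c * total f (2 * suc j) ≡ Ge (suc j)
  atEven j o = begin
    c * total f (2 * suc j)                            ≡⟨ cong (λ n → c * total f n) (ℕ.*-suc 2 j) ⟩
    c * (total f (1 + 2 * j) + f (2 + 2 * j))          ≡⟨ ℕ.*-distribˡ-+ c (total f (1 + 2 * j)) _ ⟩
    c * total f (1 + 2 * j) + c * f (2 + 2 * j)        ≡⟨ cong₂ _+_ o (trans (cong (λ n → c * f n) (sym (ℕ.*-suc 2 j))) (f-even (suc j))) ⟩
    Go j + Fe (suc j)                                  ≡⟨ sym (even-step j) ⟩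
    Ge (suc j)                                         ∎
  both : ∀ j → c * total f (2 * j) ≡ Ge j × c * total f (1 + 2 * j) ≡ Go j
  both zero    = let e = trans (f-even 0) (sym base) in e , atOdd 0 e
  both (suc j) = let e = atEven j (proj₂ (both j)) in e , atOdd (suc j) e

total-shapes : ∀ j → 60 * total #shapes (2 * j) ≡ 60 * (j * j * j * j) + 120 * (j * j * j) + 90 * (j * j) + 30 * j
                   × 60 * total #shapes (1 + 2 * j) ≡ 60 * (j * j * j * j) + 240 * (j * j * j) + 360 * (j * j) + 240 * j + 60
total-shapes = total-parity 60 #shapes _ _ _ _ #shapes-even #shapes-odd refl odd-step even-step
  where
  odd-step : ∀ j → 60 * (j * j * j * j) + 240 * (j * j * j) + 360 * (j * j) + 240 * j + 60
                   ≡ 60 * (j * j * j * j) + 120 * (j * j * j) + 90 * (j * j) + 30 * j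
                     + (120 * (j * j * j) + 270 * (j * j) + 210 * j + 60)
  odd-step = solve-∀
  even-step : ∀ j → 60 * (suc j * suc j * suc j * suc j) + 120 * (suc j * suc j * suc j) + 90 * (suc j * suc j) + 30 * suc j
                    ≡ 60 * (j * j * j * j) + 240 * (j * j * j) + 360 * (j * j) + 240 * j + 60
                      + (120 * (suc j * suc j * suc j) + 90 * (suc j * suc j) + 30 * suc j)
  even-step = solve-∀

total²-shapes : ∀ j → 60 * total (total #shapes) (2 * j)
                      ≡ 24 * (j * j * j * j * j) + 90 * (j * j * j * j) + 130 * (j * j * j) + 90 * (j * j) + 26 * j
                    × 60 * total (total #shapes) (1 + 2 * j)
                      ≡ 24 * (j * j * j * j * j) + 150 * (j * j * j * j) + 370 * (j * j * j) + 450 * (j * j) + 266 * j + 60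
total²-shapes = total-parity 60 (total #shapes) _ _ _ _
                  (λ j → proj₁ (total-shapes j)) (λ j → proj₂ (total-shapes j)) refl odd-step even-step
  where
  odd-step : ∀ j → 24 * (j * j * j * j * j) + 150 * (j * j * j * j) + 370 * (j * j * j) + 450 * (j * j) + 266 * j + 60
                   ≡ 24 * (j * j * j * j * j) + 90 * (j * j * j * j) + 130 * (j * j * j) + 90 * (j * j) + 26 * j
                     + (60 * (j * j * j * j) + 240 * (j * j * j) + 360 * (j * j) + 240 * j + 60)
  odd-step = solve-∀
  even-step : ∀ j → 24 * (suc j * suc j * suc j * suc j * suc j) + 90 * (suc j * suc j * suc j * suc j)
                    + 130 * (suc j * suc j * suc j) + 90 * (suc j * suc j) + 26 * suc j
                    ≡ 24 * (j * j * j * j * j) + 150 * (j * j * j * j) + 370 * (j * j * j) + 450 * (j * j) + 266 * j + 60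
                      + (60 * (suc j * suc j * suc j * suc j) + 120 * (suc j * suc j * suc j) + 90 * (suc j * suc j) + 30 * suc j)
  even-step = solve-∀

total³-shapes : ∀ j → 60 * total (total (total #shapes)) (2 * j)
                      ≡ 8 * (j * j * j * j * j * j) + 48 * (j * j * j * j * j) + 115 * (j * j * j * j)
                        + 140 * (j * j * j) + 87 * (j * j) + 22 * j
                    × 60 * total (total (total #shapes)) (1 + 2 * j)
                      ≡ 8 * (j * j * j * j * j * j) + 72 * (j * j * j * j * j) + 265 * (j * j * j * j)
                        + 510 * (j * j * j) + 537 * (j * j) + 288 * j + 60
total³-shapes = total-parity 60 (total (total #shapes)) _ _ _ _
                  (λ j → proj₁ (total²-shapes j)) (λ j → proj₂ (total²-shapes j)) refl odd-step even-step
  where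
  odd-step : ∀ j → 8 * (j * j * j * j * j * j) + 72 * (j * j * j * j * j) + 265 * (j * j * j * j)
                   + 510 * (j * j * j) + 537 * (j * j) + 288 * j + 60
                   ≡ 8 * (j * j * j * j * j * j) + 48 * (j * j * j * j * j) + 115 * (j * j * j * j)
                     + 140 * (j * j * j) + 87 * (j * j) + 22 * j
                     + (24 * (j * j * j * j * j) + 150 * (j * j * j * j) + 370 * (j * j * j) + 450 * (j * j) + 266 * j + 60)
  odd-step = solve-∀
  even-step : ∀ j → 8 * (suc j * suc j * suc j * suc j * suc j * suc j) + 48 * (suc j * suc j * suc j * suc j * suc j)
                    + 115 * (suc j * suc j * suc j * suc j) + 140 * (suc j * suc j * suc j) + 87 * (suc j * suc j) + 22 * suc j
                    ≡ 8 * (j * j * j * j * j * j) + 72 * (j * j * j * j * j) + 265 * (j * j * j * j)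
                      + 510 * (j * j * j) + 537 * (j * j) + 288 * j + 60
                      + (24 * (suc j * suc j * suc j * suc j * suc j) + 90 * (suc j * suc j * suc j * suc j)
                         + 130 * (suc j * suc j * suc j) + 90 * (suc j * suc j) + 26 * suc j)
  even-step = solve-∀

-- A placement (r , q , p , k , s) is a shape s of index k whose bounding triangle, of side k + 2,
-- has lower-left corner (p , q) and lies at distance r from the third side of the big triangle.
Placement : Set
Placement = ℕ × ℕ × ℕ × ℕ × Shape

indexed : ℕ → Shape → ℕ × Shape
indexed k s = k , s

sizedShapes : ℕ → List (ℕ × Shape)
sizedShapes k = map (indexed k) (shapes k)

placements : ℕ → List Placement
placements zero          = []
placements (suc zero)    = []
placements (suc (suc n)) = withSlack (withSlack (withSlack sizedShapes)) n

∈-placements⁺ : ∀ {n r q p k s} → r + (q + (p + (2 + k))) ≡ n → s ∈ shapes k → (r , q , p , k , s) ∈ placements n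
∈-placements⁺ {r = r} {q} {p} {k} {s} total≡n s∈ =
  subst (λ n → (r , q , p , k , s) ∈ placements n) (trans (shift r q p k) total≡n)
        (∈-withSlack⁺ r (∈-withSlack⁺ q (∈-withSlack⁺ p (∈-map⁺ (indexed k) s∈))))
  where
  shift : ∀ r q p k → 2 + (r + (q + (p + k))) ≡ r + (q + (p + (2 + k)))
  shift = solve-∀

∈-placements⁻ : ∀ n {r q p k s} → (r , q , p , k , s) ∈ placements n → r + (q + (p + (2 + k))) ≡ n × s ∈ shapes k
∈-placements⁻ (suc (suc n)) {r} {q} {p} {k} h with ∈-withSlack⁻ n h
... | m₁ , r+m₁≡n , h₁ with ∈-withSlack⁻ m₁ h₁
...   | m₂ , refl , h₂ with ∈-withSlack⁻ m₂ h₂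
...     | m₃ , refl , h₃ with ∈-map⁻ (indexed m₃) h₃
...       | s , s∈ , refl = trans (shift r q p k) (cong (λ t → 2 + t) r+m₁≡n) , s∈
  where
  shift : ∀ r q p k → r + (q + (p + (2 + k))) ≡ 2 + (r + (q + (p + k)))
  shift = solve-∀

placements-unique : ∀ n → Unique (placements n)
placements-unique zero          = []
placements-unique (suc zero)    = []
placements-unique (suc (suc n)) =
  withSlack-unique (withSlack-unique (withSlack-unique sized-unique)) n
  where
  sized-unique : ∀ k → Unique (sizedShapes k)
  sized-unique k = Unique.map⁺ (λ { refl → refl }) (shapes-unique k)

length-placements : ∀ n → length (placements (2 + n)) ≡ total (total (total #shapes)) n
length-placements = level (level (level (λ k → length-map (indexed k) (shapes k))))
  where
  level : {A : Set} {F : ℕ → List A} {f : ℕ → ℕ} → (∀ k → length (F k) ≡ f k) → ∀ n → length (withSlack F n) ≡ total f n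
  level F≡f n = trans (length-withSlack n) (total-cong F≡f n)

placements-odd : ∀ k → 60 * length (placements (1 + 2 * k)) + (3 * k ^ 2 + 4 * k)
                      ≡ 8 * k ^ 6 + 24 * k ^ 5 + 25 * k ^ 4 + 10 * k ^ 3
placements-odd zero    = refl
placements-odd (suc j) = begin
  60 * length (placements (1 + 2 * suc j)) + (3 * suc j ^ 2 + 4 * suc j)
    ≡⟨ cong (λ c → 60 * c + (3 * suc j ^ 2 + 4 * suc j))
            (trans (cong (λ n → length (placements (1 + n))) (ℕ.*-suc 2 j)) (length-placements (1 + 2 * j))) ⟩
  60 * total (total (total #shapes)) (1 + 2 * j) + (3 * suc j ^ 2 + 4 * suc j)
    ≡⟨ cong (_+ (3 * suc j ^ 2 + 4 * suc j)) (proj₂ (total³-shapes j)) ⟩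
  8 * (j * j * j * j * j * j) + 72 * (j * j * j * j * j) + 265 * (j * j * j * j)
    + 510 * (j * j * j) + 537 * (j * j) + 288 * j + 60 + (3 * suc j ^ 2 + 4 * suc j)
    ≡⟨ expand j ⟩
  8 * suc j ^ 6 + 24 * suc j ^ 5 + 25 * suc j ^ 4 + 10 * suc j ^ 3 ∎
  where
  open ≡-Reasoning
  expand : ∀ j → 8 * (j * j * j * j * j * j) + 72 * (j * j * j * j * j) + 265 * (j * j * j * j)
                 + 510 * (j * j * j) + 537 * (j * j) + 288 * j + 60
                 + (3 * (suc j * (suc j * 1)) + 4 * suc j)
               ≡ 8 * (suc j * (suc j * (suc j * (suc j * (suc j * (suc j * 1))))))
                 + 24 * (suc j * (suc j * (suc j * (suc j * (suc j * 1)))))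
                 + 25 * (suc j * (suc j * (suc j * (suc j * 1)))) + 10 * (suc j * (suc j * (suc j * 1)))
  expand = solve-∀

placements-even : ∀ k → 60 * length (placements (2 * suc k)) + (5 * suc k ^ 4 + 3 * suc k ^ 2) ≡ 8 * suc k ^ 6
placements-even k = begin
  60 * length (placements (2 * suc k)) + (5 * suc k ^ 4 + 3 * suc k ^ 2)
    ≡⟨ cong (λ c → 60 * c + (5 * suc k ^ 4 + 3 * suc k ^ 2))
            (trans (cong (λ n → length (placements n)) (ℕ.*-suc 2 k)) (length-placements (2 * k))) ⟩
  60 * total (total (total #shapes)) (2 * k) + (5 * suc k ^ 4 + 3 * suc k ^ 2)
    ≡⟨ cong (_+ (5 * suc k ^ 4 + 3 * suc k ^ 2)) (proj₁ (total³-shapes k)) ⟩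
  8 * (k * k * k * k * k * k) + 48 * (k * k * k * k * k) + 115 * (k * k * k * k)
    + 140 * (k * k * k) + 87 * (k * k) + 22 * k + (5 * suc k ^ 4 + 3 * suc k ^ 2)
    ≡⟨ expand k ⟩
  8 * suc k ^ 6 ∎
  where
  open ≡-Reasoning
  expand : ∀ k → 8 * (k * k * k * k * k * k) + 48 * (k * k * k * k * k) + 115 * (k * k * k * k)
                 + 140 * (k * k * k) + 87 * (k * k) + 22 * k
                 + (5 * (suc k * (suc k * (suc k * (suc k * 1)))) + 3 * (suc k * (suc k * 1)))
               ≡ 8 * (suc k * (suc k * (suc k * (suc k * (suc k * (suc k * 1))))))
  expand = solve-∀

-- In the coordinates (a , b) the six directions of net lines are, counterclockwise,
-- D0 = (1 , 0), D1 = (0 , 1), D2 = (-1 , 1), D3 = (-1 , 0), D4 = (0 , -1), D5 = (1 , -1);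
-- `next` turns a direction by 60°.
data Dir : Set where
  D0 D1 D2 D3 D4 D5 : Dir

next : Dir → Dir
next D0 = D1
next D1 = D2
next D2 = D3
next D3 = D4
next D4 = D5
next D5 = D0

rotate : ℕ → Dir → Dir
rotate zero    d = d
rotate (suc k) d = next (rotate k d)

rotate-+ : ∀ j k d → rotate j (rotate k d) ≡ rotate (j + k) d
rotate-+ zero    k d = refl
rotate-+ (suc j) k d = cong next (rotate-+ j k d)

rotate-6 : ∀ d → rotate 6 d ≡ d
rotate-6 D0 = refl
rotate-6 D1 = refl
rotate-6 D2 = refl
rotate-6 D3 = refl
rotate-6 D4 = refl
rotate-6 D5 = refl

rotation-moves : ∀ d → rotate 1 d ≢ d × rotate 2 d ≢ d × rotate 3 d ≢ d × rotate 4 d ≢ d × rotate 5 d ≢ d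
rotation-moves D0 = (λ ()) , (λ ()) , (λ ()) , (λ ()) , (λ ())
rotation-moves D1 = (λ ()) , (λ ()) , (λ ()) , (λ ()) , (λ ())
rotation-moves D2 = (λ ()) , (λ ()) , (λ ()) , (λ ()) , (λ ())
rotation-moves D3 = (λ ()) , (λ ()) , (λ ()) , (λ ()) , (λ ())
rotation-moves D4 = (λ ()) , (λ ()) , (λ ()) , (λ ()) , (λ ())
rotation-moves D5 = (λ ()) , (λ ()) , (λ ()) , (λ ()) , (λ ())

fixed-rotation : ∀ k d → k ≤ 6 → rotate k d ≡ d → k ≡ 0 ⊎ k ≡ 6
fixed-rotation 0 d _ _ = inj₁ refl
fixed-rotation 1 d _ e = ⊥-elim (proj₁ (rotation-moves d) e)
fixed-rotation 2 d _ e = ⊥-elim (proj₁ (proj₂ (rotation-moves d)) e)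
fixed-rotation 3 d _ e = ⊥-elim (proj₁ (proj₂ (proj₂ (rotation-moves d))) e)
fixed-rotation 4 d _ e = ⊥-elim (proj₁ (proj₂ (proj₂ (proj₂ (rotation-moves d)))) e)
fixed-rotation 5 d _ e = ⊥-elim (proj₂ (proj₂ (proj₂ (proj₂ (rotation-moves d)))) e)
fixed-rotation 6 d _ _ = inj₂ refl
fixed-rotation (suc (suc (suc (suc (suc (suc (suc k))))))) d (s≤s (s≤s (s≤s (s≤s (s≤s (s≤s ())))))) _

δa δb : Dir → ℤ
δa D0 = + 1
δa D1 = + 0
δa D2 = ℤ.- + 1
δa D3 = ℤ.- + 1
δa D4 = + 0
δa D5 = + 1
δb D0 = + 0
δb D1 = + 1
δb D2 = + 1
δb D3 = + 0
δb D4 = ℤ.- + 1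
δb D5 = ℤ.- + 1

turn : Dir → Dir → ℤ
turn d d′ = δa d ℤ.* δb d′ ℤ.- δb d ℤ.* δa d′

turn-self : ∀ d → turn d d ≡ + 0
turn-self d = antisym (δa d) (δb d)
  where
  antisym : ∀ x y → x ℤ.* y ℤ.- y ℤ.* x ≡ + 0
  antisym = ℤ-solve-∀

turn-table : ∀ d → turn d (rotate 1 d) ≡ + 1 × turn d (rotate 2 d) ≡ + 1 × turn d (rotate 3 d) ≡ + 0
                 × turn d (rotate 5 d) ≡ ℤ.- + 1
turn-table D0 = refl , refl , refl , refl
turn-table D1 = refl , refl , refl , refl
turn-table D2 = refl , refl , refl , refl
turn-table D3 = refl , refl , refl , refl
turn-table D4 = refl , refl , refl , refl
turn-table D5 = refl , refl , refl , refl

-- A left turn is a turn by 60° (sharp = false) or by 120° (sharp = true).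
size : Bool → ℕ
size false = 1
size true  = 2

Turn : Dir → Dir → Set
Turn d d′ = Σ Bool λ sharp → d′ ≡ rotate (size sharp) d

positive-turn : ∀ d d′ → + 0 ℤ.< turn d d′ → Turn d d′
positive-turn D0 D0 (+<+ ())
positive-turn D0 D1 _ = false , refl
positive-turn D0 D2 _ = true , refl
positive-turn D0 D3 (+<+ ())
positive-turn D0 D4 ()
positive-turn D0 D5 ()
positive-turn D1 D0 ()
positive-turn D1 D1 (+<+ ())
positive-turn D1 D2 _ = false , refl
positive-turn D1 D3 _ = true , refl
positive-turn D1 D4 (+<+ ())
positive-turn D1 D5 ()
positive-turn D2 D0 ()
positive-turn D2 D1 ()
positive-turn D2 D2 (+<+ ())
positive-turn D2 D3 _ = false , refl
positive-turn D2 D4 _ = true , refl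
positive-turn D2 D5 (+<+ ())
positive-turn D3 D0 (+<+ ())
positive-turn D3 D1 ()
positive-turn D3 D2 ()
positive-turn D3 D3 (+<+ ())
positive-turn D3 D4 _ = false , refl
positive-turn D3 D5 _ = true , refl
positive-turn D4 D0 _ = true , refl
positive-turn D4 D1 (+<+ ())
positive-turn D4 D2 ()
positive-turn D4 D3 ()
positive-turn D4 D4 (+<+ ())
positive-turn D4 D5 _ = false , refl
positive-turn D5 D0 _ = false , refl
positive-turn D5 D1 _ = true , refl
positive-turn D5 D2 (+<+ ())
positive-turn D5 D3 ()
positive-turn D5 D4 ()
positive-turn D5 D5 (+<+ ())

-- If six left turns lead from a direction back to itself, then the turns add up to 6 plus
-- the number of sharp turns, which must be a multiple of 6: either no turn is sharp, or all are.
bit : Bool → ℕ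
bit false = 0
bit true  = 1

size≡suc-bit : ∀ b → size b ≡ suc (bit b)
size≡suc-bit false = refl
size≡suc-bit true  = refl

bits : List Bool → ℕ
bits []       = 0
bits (b ∷ bs) = bit b + bits bs

bits≤length : ∀ bs → bits bs ≤ length bs
bits≤length []           = z≤n
bits≤length (false ∷ bs) = ℕ.m≤n⇒m≤1+n (bits≤length bs)
bits≤length (true ∷ bs)  = s≤s (bits≤length bs)

bits≡0 : ∀ bs → bits bs ≡ 0 → All (_≡ false) bs
bits≡0 []           _ = []
bits≡0 (false ∷ bs) e = refl ∷ bits≡0 bs e

bits≡length : ∀ bs → bits bs ≡ length bs → All (_≡ true) bs
bits≡length []           _ = []
bits≡length (true ∷ bs)  e = refl ∷ bits≡length bs (ℕ.suc-injective e)
bits≡length (false ∷ bs) e = ⊥-elim (ℕ.<-irrefl refl (subst (_≤ length bs) e (bits≤length bs)))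

turnAll : List Bool → Dir → Dir
turnAll []       d = d
turnAll (b ∷ bs) d = turnAll bs (rotate (size b) d)

turnAll-rotate : ∀ bs d → turnAll bs d ≡ rotate (length bs + bits bs) d
turnAll-rotate []       d = refl
turnAll-rotate (b ∷ bs) d = begin
  turnAll bs (rotate (size b) d)                     ≡⟨ turnAll-rotate bs (rotate (size b) d) ⟩
  rotate (length bs + bits bs) (rotate (size b) d)   ≡⟨ rotate-+ (length bs + bits bs) (size b) d ⟩
  rotate (length bs + bits bs + size b) d            ≡⟨ cong (λ s → rotate (length bs + bits bs + s) d) (size≡suc-bit b) ⟩
  rotate (length bs + bits bs + suc (bit b)) d       ≡⟨ cong (λ n → rotate n d) (regroup (length bs) (bits bs) (bit b)) ⟩
  rotate (suc (length bs) + (bit b + bits bs)) d     ∎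
  where
  open ≡-Reasoning
  regroup : ∀ l s b → l + s + suc b ≡ suc l + (b + s)
  regroup = solve-∀

closed-turns : ∀ {d0 d1 d2 d3 d4 d5} →
  Turn d0 d1 → Turn d1 d2 → Turn d2 d3 → Turn d3 d4 → Turn d4 d5 → Turn d5 d0 →
  (d1 ≡ rotate 1 d0 × d2 ≡ rotate 2 d0 × d3 ≡ rotate 3 d0 × d4 ≡ rotate 4 d0 × d5 ≡ rotate 5 d0) ⊎ d3 ≡ d0
closed-turns {d0} (b0 , refl) (b1 , refl) (b2 , refl) (b3 , refl) (b4 , refl) (b5 , closes)
  with fixed-rotation (bits sharps) d0 (bits≤length sharps) winding
  where
  sharps : List Bool
  sharps = b0 ∷ b1 ∷ b2 ∷ b3 ∷ b4 ∷ b5 ∷ []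
  winding : rotate (bits sharps) d0 ≡ d0
  winding = begin
    rotate (bits sharps) d0              ≡⟨ sym (rotate-6 _) ⟩
    rotate 6 (rotate (bits sharps) d0)   ≡⟨ rotate-+ 6 (bits sharps) d0 ⟩
    rotate (6 + bits sharps) d0          ≡⟨ sym (turnAll-rotate sharps d0) ⟩
    turnAll sharps d0                    ≡⟨ sym closes ⟩
    d0                                   ∎
    where open ≡-Reasoning
... | inj₁ none with bits≡0 (b0 ∷ b1 ∷ b2 ∷ b3 ∷ b4 ∷ b5 ∷ []) none
...   | refl ∷ refl ∷ refl ∷ refl ∷ refl ∷ refl ∷ [] = inj₁ (refl , refl , refl , refl , refl)
closed-turns {d0} (b0 , refl) (b1 , refl) (b2 , refl) (b3 , refl) (b4 , refl) (b5 , closes) | inj₂ all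
  with bits≡length (b0 ∷ b1 ∷ b2 ∷ b3 ∷ b4 ∷ b5 ∷ []) all
... | refl ∷ refl ∷ refl ∷ refl ∷ refl ∷ refl ∷ [] = inj₂ (rotate-6 d0)

-- Steps.  Step d l u v says that v = u + l·(unit vector of d), in the natural-number coordinates of
-- the net; an Edge is a step of positive length 1 + k.
Step : Dir → ℕ → Point → Point → Set
Step D0 l (a , b) (a′ , b′) = a′ ≡ a + l × b′ ≡ b
Step D1 l (a , b) (a′ , b′) = a′ ≡ a × b′ ≡ b + l
Step D2 l (a , b) (a′ , b′) = a ≡ a′ + l × b′ ≡ b + l
Step D3 l (a , b) (a′ , b′) = a ≡ a′ + l × b′ ≡ b
Step D4 l (a , b) (a′ , b′) = a′ ≡ a × b ≡ b′ + l
Step D5 l (a , b) (a′ , b′) = a′ ≡ a + l × b ≡ b′ + l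

record Edge (d : Dir) (u v : Point) : Set where
  constructor edge
  field
    k    : ℕ
    step : Step d (suc k) u v

Move : Dir → ℕ → Point → Point → Set
Move d l (a , b) (a′ , b′) = + a′ ≡ + a ℤ.+ + l ℤ.* δa d × + b′ ≡ + b ℤ.+ + l ℤ.* δb d

coord-plus : ∀ x l → x ℤ.+ l ≡ x ℤ.+ l ℤ.* + 1
coord-plus = ℤ-solve-∀

coord-same : ∀ x l → x ≡ x ℤ.+ l ℤ.* + 0
coord-same = ℤ-solve-∀

coord-minus : ∀ x l → x ≡ (x ℤ.+ l) ℤ.+ l ℤ.* ℤ.- + 1
coord-minus = ℤ-solve-∀

step⇒move : ∀ d {l u v} → Step d l u v → Move d l u v
step⇒move D0 {l} {a , b}          (refl , refl) = coord-plus (+ a) (+ l)   , coord-same (+ b) (+ l)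
step⇒move D1 {l} {a , b}          (refl , refl) = coord-same (+ a) (+ l)   , coord-plus (+ b) (+ l)
step⇒move D2 {l} {_ , b} {a′ , _} (refl , refl) = coord-minus (+ a′) (+ l) , coord-plus (+ b) (+ l)
step⇒move D3 {l} {_ , b} {a′ , _} (refl , refl) = coord-minus (+ a′) (+ l) , coord-same (+ b) (+ l)
step⇒move D4 {l} {a , _} {_ , b′} (refl , refl) = coord-same (+ a) (+ l)   , coord-minus (+ b′) (+ l)
step⇒move D5 {l} {a , _} {_ , b′} (refl , refl) = coord-plus (+ a) (+ l)   , coord-minus (+ b′) (+ l)

-- Heights.  height d u is the cross product of the unit vector of d with u: it is constant along
-- lines of direction d and grows towards their left.
height : Dir → Point → ℤ
height d (a , b) = δa d ℤ.* + b ℤ.- δb d ℤ.* + a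

cross-step : ∀ d {l o p} q → Step d l o p → cross o p q ≡ + l ℤ.* (height d q ℤ.- height d o)
cross-step d {l} {a₀ , b₀} {a₁ , b₁} (a₂ , b₂) s =
  subst₂ (λ A₁ B₁ → (A₁ ℤ.- + a₀) ℤ.* (+ b₂ ℤ.- + b₀) ℤ.- (B₁ ℤ.- + b₀) ℤ.* (+ a₂ ℤ.- + a₀)
                    ≡ + l ℤ.* (height d (a₂ , b₂) ℤ.- height d (a₀ , b₀)))
         (sym (proj₁ (step⇒move d s))) (sym (proj₂ (step⇒move d s)))
         (expand (+ a₀) (+ b₀) (+ a₂) (+ b₂) (+ l) (δa d) (δb d))
  where
  expand : ∀ a₀ b₀ a₂ b₂ l x y →
    (a₀ ℤ.+ l ℤ.* x ℤ.- a₀) ℤ.* (b₂ ℤ.- b₀) ℤ.- (b₀ ℤ.+ l ℤ.* y ℤ.- b₀) ℤ.* (a₂ ℤ.- a₀)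
    ≡ l ℤ.* ((x ℤ.* b₂ ℤ.- y ℤ.* a₂) ℤ.- (x ℤ.* b₀ ℤ.- y ℤ.* a₀))
  expand = ℤ-solve-∀

height-step : ∀ d d′ {l u v} → Step d′ l u v → height d v ≡ height d u ℤ.+ + l ℤ.* turn d d′
height-step d d′ {l} {a , b} {a′ , b′} s =
  subst₂ (λ A′ B′ → δa d ℤ.* B′ ℤ.- δb d ℤ.* A′ ≡ height d (a , b) ℤ.+ + l ℤ.* turn d d′)
         (sym (proj₁ (step⇒move d′ s))) (sym (proj₂ (step⇒move d′ s)))
         (expand (+ a) (+ b) (+ l) (δa d) (δb d) (δa d′) (δb d′))
  where
  expand : ∀ a b l x y x′ y′ → x ℤ.* (b ℤ.+ l ℤ.* y′) ℤ.- y ℤ.* (a ℤ.+ l ℤ.* x′)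
                              ≡ (x ℤ.* b ℤ.- y ℤ.* a) ℤ.+ l ℤ.* (x ℤ.* y′ ℤ.- y ℤ.* x′)
  expand = ℤ-solve-∀

height-step-by : ∀ d d′ {l u v c} → Step d′ l u v → turn d d′ ≡ c → height d v ≡ height d u ℤ.+ + l ℤ.* c
height-step-by d d′ {l} {u} s turn≡c = trans (height-step d d′ s) (cong (λ c → height d u ℤ.+ + l ℤ.* c) turn≡c)

height-flat : ∀ d {l u v} → Step d l u v → height d v ≡ height d u
height-flat d {l} {u} s = trans (height-step-by d d s (turn-self d)) (sym (coord-same (height d u) (+ l)))

sub-pos : ∀ {x y} → + 0 ℤ.< y ℤ.- x → x ℤ.< y
sub-pos {x} {y} h = subst₂ ℤ._<_ (ℤ.+-identityˡ x) (cancel x y) (ℤ.+-monoˡ-< x h)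
  where
  cancel : ∀ x y → y ℤ.- x ℤ.+ x ≡ y
  cancel = ℤ-solve-∀

pos-sub : ∀ {x y} → x ℤ.< y → + 0 ℤ.< y ℤ.- x
pos-sub {x} {y} h = subst (ℤ._< y ℤ.- x) (ℤ.+-inverseʳ x) (ℤ.+-monoˡ-< (ℤ.- x) h)

above : ∀ {x y} t → y ≡ x ℤ.+ + suc t → x ℤ.< y
above {x} t refl = subst (ℤ._< x ℤ.+ + suc t) (ℤ.+-identityʳ x) (ℤ.+-monoʳ-< x (+<+ (s≤s z≤n)))

scale-pos⁺ : ∀ t {w} → + 0 ℤ.< w → + 0 ℤ.< + suc t ℤ.* w
scale-pos⁺ t {w} h = subst (ℤ._< + suc t ℤ.* w) (ℤ.*-zeroʳ (+ suc t)) (ℤ.*-monoˡ-<-pos (+ suc t) h)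

scale-pos⁻ : ∀ l {w} → + 0 ℤ.< + l ℤ.* w → + 0 ℤ.< w
scale-pos⁻ l {w} h = ℤ.*-cancelˡ-<-nonNeg (+ l) (subst (ℤ._< + l ℤ.* w) (sym (ℤ.*-zeroʳ (+ l))) h)

nonzero-factor : ∀ t y → + suc t ℤ.* y ≡ + 0 → y ≡ + 0
nonzero-factor t y e = [ (λ ()) , (λ y≡0 → y≡0) ]′ (ℤ.i*j≡0⇒i≡0∨j≡0 (+ suc t) e)

left⇒higher : ∀ d {t o p q} → Step d (suc t) o p → T (strictlyLeft o p q) → height d o ℤ.< height d q
left⇒higher d {t} {q = q} s left =
  sub-pos (scale-pos⁻ (suc t) (subst (ℤ._<_ (+ 0)) (cross-step d q s) (toWitness left)))

higher⇒left : ∀ d {t o p q} → Step d (suc t) o p → height d o ℤ.< height d q → T (strictlyLeft o p q)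
higher⇒left d {t} {q = q} s higher =
  fromWitness (subst (ℤ._<_ (+ 0)) (sym (cross-step d q s)) (scale-pos⁺ t (pos-sub higher)))

cross-degenerate : ∀ u w → cross u u w ≡ + 0
cross-degenerate (a , b) (a′ , b′) = vanish (+ a) (+ b) (+ a′) (+ b′)
  where
  vanish : ∀ a b a′ b′ → (a ℤ.- a) ℤ.* (b′ ℤ.- b) ℤ.- (b ℤ.- b) ℤ.* (a′ ℤ.- a) ≡ + 0
  vanish = ℤ-solve-∀

left⇒distinct : ∀ u v w → T (strictlyLeft u v w) → u ≢ v
left⇒distinct u _ w left refl = ℤ.<-irrefl (sym (cross-degenerate u w)) (toWitness left)

onNet⁻ : ∀ a b a′ b′ → T (onNetLine (a , b) (a′ , b′)) → a ≡ a′ ⊎ b ≡ b′ ⊎ a + b ≡ a′ + b′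
onNet⁻ a b a′ b′ h with a ℕ.≟ a′ | b ℕ.≟ b′ | (a + b) ℕ.≟ (a′ + b′)
... | yes a≡ | _      | _      = inj₁ a≡
... | no _   | yes b≡ | _      = inj₂ (inj₁ b≡)
... | no _   | no _   | yes s≡ = inj₂ (inj₂ s≡)
... | no _   | no _   | no _   = ⊥-elim h

onNet⁺ : ∀ a b a′ b′ → a ≡ a′ ⊎ b ≡ b′ ⊎ a + b ≡ a′ + b′ → T (onNetLine (a , b) (a′ , b′))
onNet⁺ a b a′ b′ p with a ℕ.≟ a′ | b ℕ.≟ b′ | (a + b) ℕ.≟ (a′ + b′)
... | yes _ | _     | _     = tt
... | no _  | yes _ | _     = tt
... | no _  | no _  | yes _ = tt
... | no a≢ | no b≢ | no s≢ = [ a≢ , [ b≢ , s≢ ]′ ]′ p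

edge⇒onNet : ∀ d {l u v} → Step d l u v → T (onNetLine u v)
edge⇒onNet D0 {l} {a , b}          (refl , refl) = onNet⁺ a b (a + l) b (inj₂ (inj₁ refl))
edge⇒onNet D1 {l} {a , b}          (refl , refl) = onNet⁺ a b a (b + l) (inj₁ refl)
edge⇒onNet D2 {l} {_ , b} {a′ , _} (refl , refl) = onNet⁺ (a′ + l) b a′ (b + l) (inj₂ (inj₂ (shuffle a′ l b)))
  where
  shuffle : ∀ a l b → a + l + b ≡ a + (b + l)
  shuffle = solve-∀
edge⇒onNet D3 {l} {_ , b} {a′ , _} (refl , refl) = onNet⁺ (a′ + l) b a′ b (inj₂ (inj₁ refl))
edge⇒onNet D4 {l} {a , _} {_ , b′} (refl , refl) = onNet⁺ a (b′ + l) a b′ (inj₁ refl)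
edge⇒onNet D5 {l} {a , _} {_ , b′} (refl , refl) = onNet⁺ a (b′ + l) (a + l) b′ (inj₂ (inj₂ (shuffle a b′ l)))
  where
  shuffle : ∀ a b l → a + (b + l) ≡ a + l + b
  shuffle = solve-∀

gap : ∀ {m n} → m < n → Σ ℕ λ t → n ≡ m + suc t
gap {m} {n} m<n = n ∸ suc m , sym (trans (ℕ.+-suc m _) (ℕ.m+[n∸m]≡n m<n))

reassoc : ∀ x t y → x + suc t + y ≡ x + (y + suc t)
reassoc = solve-∀

onNet⇒edge : ∀ u v → T (onNetLine u v) → u ≢ v → Σ Dir λ d → Edge d u v
onNet⇒edge (a , b) (a′ , b′) h u≢v with onNet⁻ a b a′ b′ h
... | inj₁ refl with ℕ.<-cmp b b′
...   | tri< b<b′ _ _ = let t , e = gap b<b′ in D1 , edge t (refl , e)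
...   | tri≈ _ refl _ = ⊥-elim (u≢v refl)
...   | tri> _ _ b>b′ = let t , e = gap b>b′ in D4 , edge t (refl , e)
onNet⇒edge (a , b) (a′ , b′) h u≢v | inj₂ (inj₁ refl) with ℕ.<-cmp a a′
...   | tri< a<a′ _ _ = let t , e = gap a<a′ in D0 , edge t (e , refl)
...   | tri≈ _ refl _ = ⊥-elim (u≢v refl)
...   | tri> _ _ a>a′ = let t , e = gap a>a′ in D3 , edge t (e , refl)
onNet⇒edge (a , b) (a′ , b′) h u≢v | inj₂ (inj₂ sums) with ℕ.<-cmp a a′
...   | tri< a<a′ _ _ = let t , e = gap a<a′ in
    D5 , edge t (e , ℕ.+-cancelˡ-≡ a b (b′ + suc t) (trans sums (trans (cong (_+ b′) e) (reassoc a t b′))))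
...   | tri≈ _ refl _ = ⊥-elim (u≢v (cong (a ,_) (ℕ.+-cancelˡ-≡ a b b′ sums)))
...   | tri> _ _ a>a′ = let t , e = gap a>a′ in
    D2 , edge t (e , ℕ.+-cancelˡ-≡ a′ b′ (b + suc t) (trans (sym sums) (trans (cong (_+ b) e) (reassoc a′ t b))))

Hexagon : Set
Hexagon = Vec Point 6

Regular : Dir → Hexagon → Set
Regular d (v0 ∷ v1 ∷ v2 ∷ v3 ∷ v4 ∷ v5 ∷ []) =
  Edge d v0 v1 × Edge (rotate 1 d) v1 v2 × Edge (rotate 2 d) v2 v3 ×
  Edge (rotate 3 d) v3 v4 × Edge (rotate 4 d) v4 v5 × Edge (rotate 5 d) v5 v0

shift : Hexagon → Hexagon
shift (v0 ∷ v1 ∷ v2 ∷ v3 ∷ v4 ∷ v5 ∷ []) = v1 ∷ v2 ∷ v3 ∷ v4 ∷ v5 ∷ v0 ∷ []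

shifts : ℕ → Hexagon → Hexagon
shifts zero    v = v
shifts (suc i) v = shift (shifts i v)

regular-shift : ∀ d v → Regular d v → Regular (next d) (shift v)
regular-shift d (v0 ∷ v1 ∷ _ ∷ _ ∷ _ ∷ _ ∷ []) (e0 , e1 , e2 , e3 , e4 , e5) =
  e1 , e2 , e3 , e4 , e5 , subst (λ d′ → Edge d′ v0 v1) (sym (rotate-6 d)) e0

regular-shifts : ∀ i d v → Regular d v → Regular (rotate i d) (shifts i v)
regular-shifts zero    d v r = r
regular-shifts (suc i) d v r = regular-shift (rotate i d) (shifts i v) (regular-shifts i d v r)

ConvexSide : Point → Point → Point → Point → Point → Point → Set
ConvexSide a b c d e f =
  T (onNetLine a b) × T (strictlyLeft a b c) × T (strictlyLeft a b d) × T (strictlyLeft a b e) × T (strictlyLeft a b f)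

Convex : Hexagon → Set
Convex (v0 ∷ v1 ∷ v2 ∷ v3 ∷ v4 ∷ v5 ∷ []) =
  ConvexSide v0 v1 v2 v3 v4 v5 × ConvexSide v1 v2 v3 v4 v5 v0 × ConvexSide v2 v3 v4 v5 v0 v1 ×
  ConvexSide v3 v4 v5 v0 v1 v2 × ConvexSide v4 v5 v0 v1 v2 v3 × ConvexSide v5 v0 v1 v2 v3 v4

-- Along a regular path, every vertex after v1 is strictly higher than v0 with respect to the first
-- direction: the second and third sides climb, the fourth is parallel to the first, and the sixth
-- descends into v0.
regular-above : ∀ d v0 v1 v2 v3 v4 v5 → Regular d (v0 ∷ v1 ∷ v2 ∷ v3 ∷ v4 ∷ v5 ∷ []) →
  height d v0 ℤ.< height d v2 × height d v0 ℤ.< height d v3 ×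
  height d v0 ℤ.< height d v4 × height d v0 ℤ.< height d v5
regular-above d v0 v1 v2 v3 v4 v5 (edge _ s0 , edge t1 s1 , edge t2 s2 , edge t3 s3 , _ , edge t5 s5) =
  above t1 at-v2 , above (t1 + suc t2) at-v3 , above (t1 + suc t2) (trans at-v4 at-v3) , above t5 at-v5
  where
  h : Point → ℤ
  h = height d
  at-v2 : h v2 ≡ h v0 ℤ.+ + suc t1
  at-v2 = trans (height-step-by d (rotate 1 d) s1 (proj₁ (turn-table d)))
                (trans (cong (λ x → x ℤ.+ + suc t1 ℤ.* + 1) (height-flat d s0)) (sym (coord-plus (h v0) (+ suc t1))))
  at-v3 : h v3 ≡ h v0 ℤ.+ + (suc t1 + suc t2)
  at-v3 = trans (height-step-by d (rotate 2 d) s2 (proj₁ (proj₂ (turn-table d))))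
                (trans (cong (λ x → x ℤ.+ + suc t2 ℤ.* + 1) at-v2) (regroup (h v0) (+ suc t1) (+ suc t2)))
    where
    regroup : ∀ x l l′ → x ℤ.+ l ℤ.+ l′ ℤ.* + 1 ≡ x ℤ.+ (l ℤ.+ l′)
    regroup = ℤ-solve-∀
  at-v4 : h v4 ≡ h v3
  at-v4 = trans (height-step-by d (rotate 3 d) s3 (proj₁ (proj₂ (proj₂ (turn-table d))))) (sym (coord-same (h v3) (+ suc t3)))
  at-v5 : h v5 ≡ h v0 ℤ.+ + suc t5
  at-v5 = trans (back (h v5) (+ suc t5))
                (cong (ℤ._+ + suc t5) (sym (height-step-by d (rotate 5 d) s5 (proj₂ (proj₂ (proj₂ (turn-table d)))))))
    where
    back : ∀ x l → x ≡ x ℤ.+ l ℤ.* ℤ.- + 1 ℤ.+ l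
    back = ℤ-solve-∀

regular-side : ∀ d v0 v1 v2 v3 v4 v5 → Regular d (v0 ∷ v1 ∷ v2 ∷ v3 ∷ v4 ∷ v5 ∷ []) → ConvexSide v0 v1 v2 v3 v4 v5
regular-side d v0 v1 v2 v3 v4 v5 r =
  edge⇒onNet d s0 , higher⇒left d s0 at2 , higher⇒left d s0 at3 , higher⇒left d s0 at4 , higher⇒left d s0 at5
  where
  s0 = Edge.step (proj₁ r)
  heights = regular-above d v0 v1 v2 v3 v4 v5 r
  at2 = proj₁ heights
  at3 = proj₁ (proj₂ heights)
  at4 = proj₁ (proj₂ (proj₂ heights))
  at5 = proj₂ (proj₂ (proj₂ heights))

regular⇒convex : ∀ d v → Regular d v → Convex v
regular⇒convex d v@(v0 ∷ v1 ∷ v2 ∷ v3 ∷ v4 ∷ v5 ∷ []) r =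
  regular-side d v0 v1 v2 v3 v4 v5 r ,
  regular-side (rotate 1 d) v1 v2 v3 v4 v5 v0 (regular-shifts 1 d v r) ,
  regular-side (rotate 2 d) v2 v3 v4 v5 v0 v1 (regular-shifts 2 d v r) ,
  regular-side (rotate 3 d) v3 v4 v5 v0 v1 v2 (regular-shifts 3 d v r) ,
  regular-side (rotate 4 d) v4 v5 v0 v1 v2 v3 (regular-shifts 4 d v r) ,
  regular-side (rotate 5 d) v5 v0 v1 v2 v3 v4 (regular-shifts 5 d v r)

-- At each vertex of a convex path the direction turns left by 60° or 120°: the next vertex is
-- higher than the previous one with respect to the incoming direction.
turn-at : ∀ {d d′ u v w} → Edge d u v → Edge d′ v w → T (strictlyLeft u v w) → Turn d d′
turn-at {d} {d′} {u} {v} {w} (edge _ s) (edge t′ s′) left =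
  positive-turn d d′ (scale-pos⁻ (suc t′) (subst (ℤ._<_ (+ 0)) rise (pos-sub (left⇒higher d s left))))
  where
  rise : height d w ℤ.- height d u ≡ + suc t′ ℤ.* turn d d′
  rise = begin
    height d w ℤ.- height d u                              ≡⟨ cong (λ x → height d w ℤ.- x) (sym (height-flat d s)) ⟩
    height d w ℤ.- height d v                              ≡⟨ cong (λ x → x ℤ.- height d v) (height-step d d′ s′) ⟩
    height d v ℤ.+ + suc t′ ℤ.* turn d d′ ℤ.- height d v   ≡⟨ cancel (height d v) (+ suc t′ ℤ.* turn d d′) ⟩
    + suc t′ ℤ.* turn d d′                                 ∎
    where
    open ≡-Reasoning
    cancel : ∀ x y → x ℤ.+ y ℤ.- x ≡ y
    cancel = ℤ-solve-∀

no-parallel-sides : ∀ {d u u′ w w′} → Edge d u u′ → Edge d w w′ →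
                    T (strictlyLeft u u′ w) → T (strictlyLeft w w′ u) → ⊥
no-parallel-sides {d} (edge _ s) (edge _ s′) w-left u-left = ℤ.<-asym (left⇒higher d s w-left) (left⇒higher d s′ u-left)

regular-from-turns : ∀ {d0 d1 d2 d3 d4 d5 v0 v1 v2 v3 v4 v5} →
  Edge d0 v0 v1 → Edge d1 v1 v2 → Edge d2 v2 v3 → Edge d3 v3 v4 → Edge d4 v4 v5 → Edge d5 v5 v0 →
  T (strictlyLeft v0 v1 v3) → T (strictlyLeft v3 v4 v0) →
  (d1 ≡ rotate 1 d0 × d2 ≡ rotate 2 d0 × d3 ≡ rotate 3 d0 × d4 ≡ rotate 4 d0 × d5 ≡ rotate 5 d0) ⊎ d3 ≡ d0 →
  Σ Dir λ d → Regular d (v0 ∷ v1 ∷ v2 ∷ v3 ∷ v4 ∷ v5 ∷ [])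
regular-from-turns {d0} e0 e1 e2 e3 e4 e5 _ _ (inj₁ (refl , refl , refl , refl , refl)) = d0 , e0 , e1 , e2 , e3 , e4 , e5
regular-from-turns e0 _ _ e3 _ _ v3-left v0-left (inj₂ refl) = ⊥-elim (no-parallel-sides e0 e3 v3-left v0-left)

convex⇒regular : ∀ v → Convex v → Σ Dir λ d → Regular d v
convex⇒regular (v0 ∷ v1 ∷ v2 ∷ v3 ∷ v4 ∷ v5 ∷ [])
  ((n0 , l0 , l0′ , _ , _) , (n1 , l1 , _ , _ , _) , (n2 , l2 , _ , _ , _) ,
   (n3 , l3 , l3′ , _ , _) , (n4 , l4 , _ , _ , _) , (n5 , l5 , _ , _ , _)) =
  regular-from-turns e0 e1 e2 e3 e4 e5 l0′ l3′
    (closed-turns (turn-at e0 e1 l0) (turn-at e1 e2 l1) (turn-at e2 e3 l2)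
                  (turn-at e3 e4 l3) (turn-at e4 e5 l4) (turn-at e5 e0 l5))
  where
  e0 = proj₂ (onNet⇒edge v0 v1 n0 (left⇒distinct v0 v1 v2 l0))
  e1 = proj₂ (onNet⇒edge v1 v2 n1 (left⇒distinct v1 v2 v3 l1))
  e2 = proj₂ (onNet⇒edge v2 v3 n2 (left⇒distinct v2 v3 v4 l2))
  e3 = proj₂ (onNet⇒edge v3 v4 n3 (left⇒distinct v3 v4 v5 l3))
  e4 = proj₂ (onNet⇒edge v4 v5 n4 (left⇒distinct v4 v5 v0 l4))
  e5 = proj₂ (onNet⇒edge v5 v0 n5 (left⇒distinct v5 v0 v1 l5))

-- The direction of an edge is determined by its endpoints: the end is higher than the start with
-- respect to the previous direction (so the direction is d or d + 60°) and equally high with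
-- respect to d itself (which excludes d + 60°).
turn-behind : ∀ {d d′ u v} → Edge d u v → Edge d′ u v → + 0 ℤ.< turn (rotate 5 d) d′
turn-behind {d} {d′} {u} {v} (edge t s) (edge t′ s′) =
  scale-pos⁻ (suc t′) (subst (ℤ._<_ (+ 0)) gain (pos-sub (above t climb)))
  where
  back : Dir
  back = rotate 5 d
  climb : height back v ≡ height back u ℤ.+ + suc t
  climb = trans (height-step-by back d s (trans (cong (turn back) (sym (rotate-6 d))) (proj₁ (turn-table back))))
                (sym (coord-plus (height back u) (+ suc t)))
  gain : height back v ℤ.- height back u ≡ + suc t′ ℤ.* turn back d′
  gain = trans (cong (λ h → h ℤ.- height back u) (height-step back d′ s′)) (cancel (height back u) _)
    where
    cancel : ∀ x y → x ℤ.+ y ℤ.- x ≡ y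
    cancel = ℤ-solve-∀

turn-along : ∀ {d d′ u v} → Edge d u v → Edge d′ u v → turn d d′ ≡ + 0
turn-along {d} {d′} {u} {v} (edge _ s) (edge t′ s′) =
  nonzero-factor t′ (turn d d′) (vanish (height d u) (+ suc t′ ℤ.* turn d d′) (trans (sym (height-step d d′ s′)) (height-flat d s)))
  where
  vanish : ∀ x y → x ℤ.+ y ≡ x → y ≡ + 0
  vanish x y e = trans (expand x y) (trans (cong (ℤ._- x) e) (ℤ.+-inverseʳ x))
    where
    expand : ∀ x y → y ≡ x ℤ.+ y ℤ.- x
    expand = ℤ-solve-∀

edge-direction : ∀ {d d′ u v} → Edge d u v → Edge d′ u v → d ≡ d′
edge-direction {d} {d′} e e′ = resolve (positive-turn (rotate 5 d) d′ (turn-behind e e′)) (turn-along e e′)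
  where
  resolve : ∀ {d′} → Turn (rotate 5 d) d′ → turn d d′ ≡ + 0 → d ≡ d′
  resolve (false , refl) _     = sym (rotate-6 d)
  resolve (true  , refl) level = ⊥-elim (one≢zero (trans (sym (proj₁ (turn-table d)))
                                          (trans (cong (λ x → turn d (next x)) (sym (rotate-6 d))) level)))
    where
    one≢zero : + 1 ≢ + 0
    one≢zero ()

and⇒All : ∀ bs → T (and bs) → All T bs
and⇒All []           _ = []
and⇒All (true ∷ bs)  h = tt ∷ and⇒All bs h

All⇒and : ∀ {bs} → All T bs → T (and bs)
All⇒and []                    = tt
All⇒and {true ∷ _} (_ ∷ rest) = All⇒and rest

side⇒ : ∀ x bs → T (x ∧ and bs) → T x × All T bs
side⇒ true bs h = tt , and⇒All bs h

side⇐ : ∀ {x bs} → T x → All T bs → T (x ∧ and bs)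
side⇐ {true} _ all = All⇒and all

pointTest : Hexagon → Fin 6 → Fin 6 → Bool
pointTest v i j = isEndpoint i j ∨ strictlyLeft (lookup v i) (lookup v (nxt i)) (lookup v j)

sideTest : Hexagon → Fin 6 → Bool
sideTest v i = onNetLine (lookup v i) (lookup v (nxt i)) ∧ and (map (pointTest v i) (allFin 6))

isNetHexagon⇒convex : ∀ v → T (isNetHexagon v) → Convex v
isNetHexagon⇒convex v@(_ ∷ _ ∷ _ ∷ _ ∷ _ ∷ _ ∷ []) h =
  (net (# 0) , left (# 0) (# 2) , left (# 0) (# 3) , left (# 0) (# 4) , left (# 0) (# 5)) ,
  (net (# 1) , left (# 1) (# 3) , left (# 1) (# 4) , left (# 1) (# 5) , left (# 1) (# 0)) ,
  (net (# 2) , left (# 2) (# 4) , left (# 2) (# 5) , left (# 2) (# 0) , left (# 2) (# 1)) ,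
  (net (# 3) , left (# 3) (# 5) , left (# 3) (# 0) , left (# 3) (# 1) , left (# 3) (# 2)) ,
  (net (# 4) , left (# 4) (# 0) , left (# 4) (# 1) , left (# 4) (# 2) , left (# 4) (# 3)) ,
  (net (# 5) , left (# 5) (# 1) , left (# 5) (# 2) , left (# 5) (# 3) , left (# 5) (# 4))
  where
  side : ∀ i → T (onNetLine (lookup v i) (lookup v (nxt i))) × All T (map (pointTest v i) (allFin 6))
  side i = side⇒ _ (map (pointTest v i) (allFin 6))
                 (All.lookup (All.map⁻ {f = sideTest v} (and⇒All (map (sideTest v) (allFin 6)) h)) (∈-allFin i))
  net : ∀ i → T (onNetLine (lookup v i) (lookup v (nxt i)))
  net i = proj₁ (side i)
  left : ∀ i j → T (pointTest v i j)
  left i j = All.lookup (All.map⁻ {f = pointTest v i} (proj₂ (side i))) (∈-allFin j)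

convex⇒isNetHexagon : ∀ v → Convex v → T (isNetHexagon v)
convex⇒isNetHexagon (v0 ∷ v1 ∷ v2 ∷ v3 ∷ v4 ∷ v5 ∷ [])
  ((n0 , l02 , l03 , l04 , l05) , (n1 , l13 , l14 , l15 , l10) , (n2 , l24 , l25 , l20 , l21) ,
   (n3 , l35 , l30 , l31 , l32) , (n4 , l40 , l41 , l42 , l43) , (n5 , l51 , l52 , l53 , l54)) =
  All⇒and ( side⇐ n0 (tt ∷ tt ∷ l02 ∷ l03 ∷ l04 ∷ l05 ∷ [])
          ∷ side⇐ n1 (l10 ∷ tt ∷ tt ∷ l13 ∷ l14 ∷ l15 ∷ [])
          ∷ side⇐ n2 (l20 ∷ l21 ∷ tt ∷ tt ∷ l24 ∷ l25 ∷ [])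
          ∷ side⇐ n3 (l30 ∷ l31 ∷ l32 ∷ tt ∷ tt ∷ l35 ∷ [])
          ∷ side⇐ n4 (l40 ∷ l41 ∷ l42 ∷ l43 ∷ tt ∷ tt ∷ [])
          ∷ side⇐ n5 (tt ∷ l51 ∷ l52 ∷ l53 ∷ l54 ∷ tt ∷ [])
          ∷ [])

hexagon⇒regular : ∀ v → T (isNetHexagon v) → Σ Dir λ d → Regular d v
hexagon⇒regular v h = convex⇒regular v (isNetHexagon⇒convex v h)

regular⇒hexagon : ∀ d v → Regular d v → T (isNetHexagon v)
regular⇒hexagon d v r = convex⇒isNetHexagon v (regular⇒convex d v r)

-- The canonical labelling of a placement: v₀ is the left end of the bottom side, which has
-- direction D0; the bounding triangle has vertices (p , q), (p + k + 2 , q), (p , q + k + 2).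
corners : Placement → Hexagon
corners (r , q , p , k , x , y , z) =
  (p + suc z , q) ∷ (p + (suc k ∸ x) , q) ∷ (p + (suc k ∸ x) , q + suc x) ∷
  (p + suc y , q + (suc k ∸ y)) ∷ (p , q + (suc k ∸ y)) ∷ (p , q + suc z) ∷ []

-- the side between two corner cuts x + 1 and y + 1 has length (k + 2) - (x + 1) - (y + 1) = 1 + a
cut : ∀ {x y k} → x + y < k → Σ ℕ λ a → suc k ∸ x ≡ suc y + suc a × suc k ∸ y ≡ suc x + suc a
cut {x} {y} x+y<k with gap x+y<k
... | a , refl = a , trans (cong (_∸ x) (split₁ x y a)) (ℕ.m+n∸m≡n x (suc y + suc a))
                   , trans (cong (_∸ y) (split₂ x y a)) (ℕ.m+n∸m≡n y (suc x + suc a))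
  where
  split₁ : ∀ x y a → suc (x + y + suc a) ≡ x + (suc y + suc a)
  split₁ = solve-∀
  split₂ : ∀ x y a → suc (x + y + suc a) ≡ y + (suc x + suc a)
  split₂ = solve-∀

placement-regular : ∀ r q p k x y z → IsShape k (x , y , z) → Regular D0 (corners (r , q , p , k , x , y , z))
placement-regular r q p k x y z (xy , yz , xz) with cut xz | cut xy | cut yz
... | a0 , c0 , _ | a2 , c2 , c2′ | a4 , c4 , _ =
  edge a0 (trans (cong (λ t → p + t) c0) (sym (ℕ.+-assoc p (suc z) (suc a0))) , refl) ,
  edge x (refl , refl) ,
  edge a2 (trans (cong (λ t → p + t) c2) (sym (ℕ.+-assoc p (suc y) (suc a2))) ,
           trans (cong (λ t → q + t) c2′) (sym (ℕ.+-assoc q (suc x) (suc a2)))) ,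
  edge y (refl , refl) ,
  edge a4 (refl , trans (cong (λ t → q + t) c4) (sym (ℕ.+-assoc q (suc z) (suc a4)))) ,
  edge z (refl , refl)

InTriangle : ℕ → Point → Set
InTriangle n (a , b) = a + b ≤ n

-- Along a regular path starting in direction D0 the coordinate sum a + b rises on the first two
-- sides, is constant on the third and falls on the next two, so it is largest at v₂.
coordSum : Point → ℕ
coordSum (a , b) = a + b

sum-D0 : ∀ {l u v} → Step D0 l u v → coordSum u ≤ coordSum v
sum-D0 {l} {a , b} (refl , refl) = ℕ.+-monoˡ-≤ b (ℕ.m≤m+n a l)

sum-D1 : ∀ {l u v} → Step D1 l u v → coordSum u ≤ coordSum v
sum-D1 {l} {a , b} (refl , refl) = ℕ.+-monoʳ-≤ a (ℕ.m≤m+n b l)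

sum-D2 : ∀ {l u v} → Step D2 l u v → coordSum v ≡ coordSum u
sum-D2 {l} {_ , b} {a′ , _} (refl , refl) = shuffle a′ b l
  where
  shuffle : ∀ a b l → a + (b + l) ≡ a + l + b
  shuffle = solve-∀

sum-D3 : ∀ {l u v} → Step D3 l u v → coordSum v ≤ coordSum u
sum-D3 {l} {_ , b} {a′ , _} (refl , refl) = ℕ.+-monoˡ-≤ b (ℕ.m≤m+n a′ l)

sum-D4 : ∀ {l u v} → Step D4 l u v → coordSum v ≤ coordSum u
sum-D4 {l} {a , _} {_ , b′} (refl , refl) = ℕ.+-monoʳ-≤ a (ℕ.m≤m+n b′ l)

regular-inTriangle : ∀ n v0 v1 v2 v3 v4 v5 → Regular D0 (v0 ∷ v1 ∷ v2 ∷ v3 ∷ v4 ∷ v5 ∷ []) →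
  coordSum v2 ≤ n → VecAll.All (InTriangle n) (v0 ∷ v1 ∷ v2 ∷ v3 ∷ v4 ∷ v5 ∷ [])
regular-inTriangle n (a0 , b0) (a1 , b1) (a2 , b2) (a3 , b3) (a4 , b4) (a5 , b5)
  (edge _ s0 , edge _ s1 , edge _ s2 , edge _ s3 , edge _ s4 , _) v2-in =
  v0-in VecAll.∷ v1-in VecAll.∷ v2-in VecAll.∷ v3-in VecAll.∷ v4-in VecAll.∷ v5-in VecAll.∷ VecAll.[]
  where
  v1-in = ℕ.≤-trans (sum-D1 s1) v2-in
  v0-in = ℕ.≤-trans (sum-D0 s0) v1-in
  v3-in = subst (_≤ n) (sym (sum-D2 s2)) v2-in
  v4-in = ℕ.≤-trans (sum-D3 s3) v3-in
  v5-in = ℕ.≤-trans (sum-D4 s4) v4-in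

cancel-steps : ∀ a x y u w → a + suc x + suc y ≡ a + suc u + suc w → x + y ≡ u + w
cancel-steps a x y u w e =
  ℕ.suc-injective (ℕ.suc-injective (ℕ.+-cancelˡ-≡ a _ _ (trans (sym (reshape a x y)) (trans e (reshape a u w)))))
  where
  reshape : ∀ a x y → a + suc x + suc y ≡ a + suc (suc (x + y))
  reshape = solve-∀

<+suc : ∀ m w → m < m + suc w
<+suc m w = subst (suc m ≤_) (sym (ℕ.+-suc m w)) (s≤s (ℕ.m≤m+n m w))

-- The side lengths 1 + t₀, …, 1 + t₅ of a closed regular path starting in direction D0 satisfy
-- t₅ + t₀ = t₃ + t₂ and t₁ + t₂ = t₅ + t₄ (the a- and b-coordinates return).  Then the cuts
-- t₁, t₃, t₅ form a shape whose bounding triangle has side (1 + t₅) + (1 + t₀) + (1 + t₁).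
closing-shape : ∀ t0 t1 t2 t3 t4 t5 → t5 + t0 ≡ t3 + t2 → t1 + t2 ≡ t5 + t4 →
                IsShape (suc (t5 + t0 + t1)) (t1 , t3 , t5)
closing-shape t0 t1 t2 t3 t4 t5 A B =
  subst (t1 + t3 <_) (sym k-xy) (<+suc (t1 + t3) t2) ,
  subst (t3 + t5 <_) (sym k-yz) (<+suc (t3 + t5) t4) ,
  subst (t1 + t5 <_) (sym (arrange₁ t5 t0 t1)) (<+suc (t1 + t5) t0)
  where
  open ≡-Reasoning
  arrange₁ : ∀ a b c → suc (a + b + c) ≡ c + a + suc b
  arrange₁ = solve-∀
  -- adding the two closing conditions: t₀ + t₁ = t₃ + t₄
  C : t0 + t1 ≡ t3 + t4
  C = ℕ.+-cancelˡ-≡ t5 _ _ (ℕ.+-cancelʳ-≡ t2 _ _ (begin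
        t5 + (t0 + t1) + t2   ≡⟨ regroup₁ t5 t0 t1 t2 ⟩
        (t5 + t0) + (t1 + t2) ≡⟨ cong₂ _+_ A B ⟩
        (t3 + t2) + (t5 + t4) ≡⟨ regroup₂ t3 t2 t5 t4 ⟩
        t5 + (t3 + t4) + t2   ∎))
    where
    regroup₁ : ∀ a b c d → a + (b + c) + d ≡ (a + b) + (c + d)
    regroup₁ = solve-∀
    regroup₂ : ∀ a b c d → (a + b) + (c + d) ≡ c + (a + d) + b
    regroup₂ = solve-∀
  k-xy : suc (t5 + t0 + t1) ≡ t1 + t3 + suc t2
  k-xy = trans (cong (λ s → suc (s + t1)) A) (arrange₁ t3 t2 t1)
  k-yz : suc (t5 + t0 + t1) ≡ t3 + t5 + suc t4
  k-yz = trans (regroup t5 t0 t1) (trans (cong (λ s → suc (t5 + s)) C) (arrange₂ t5 t3 t4))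
    where
    regroup : ∀ a b c → suc (a + b + c) ≡ suc (a + (b + c))
    regroup = solve-∀
    arrange₂ : ∀ a b c → suc (a + (b + c)) ≡ b + a + suc c
    arrange₂ = solve-∀

closing-sides : ∀ t0 t1 t2 t3 t5 → t5 + t0 ≡ t3 + t2 →
  suc (suc (t5 + t0 + t1)) ∸ t1 ≡ suc t5 + suc t0 × suc (suc (t5 + t0 + t1)) ∸ t3 ≡ suc t1 + suc t2
closing-sides t0 t1 t2 t3 t5 A =
  trans (cong (_∸ t1) (arrange₁ t5 t0 t1)) (ℕ.m+n∸n≡m (suc t5 + suc t0) t1) ,
  trans (cong (λ s → suc (suc (s + t1)) ∸ t3) A) (trans (cong (_∸ t3) (arrange₂ t3 t2 t1)) (ℕ.m+n∸n≡m (suc t1 + suc t2) t3))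
  where
  arrange₁ : ∀ a b c → suc (suc (a + b + c)) ≡ suc a + suc b + c
  arrange₁ = solve-∀
  arrange₂ : ∀ a b c → suc (suc (a + b + c)) ≡ suc c + suc b + a
  arrange₂ = solve-∀

-- Every regular path starting in direction D0 inside the triangle is the canonical labelling of a
-- placement: p and q are the smallest coordinates, and the cuts are the lengths of sides 1, 3, 5
-- minus one.
canonical : ∀ n a0 b0 a1 b1 a2 b2 a3 b3 a4 b4 a5 b5 →
  Regular D0 ((a0 , b0) ∷ (a1 , b1) ∷ (a2 , b2) ∷ (a3 , b3) ∷ (a4 , b4) ∷ (a5 , b5) ∷ []) → a2 + b2 ≤ n →
  Σ Placement λ pl → pl ∈ placements n × corners pl ≡ ((a0 , b0) ∷ (a1 , b1) ∷ (a2 , b2) ∷ (a3 , b3) ∷ (a4 , b4) ∷ (a5 , b5) ∷ [])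
canonical n _ b0 _ _ _ _ _ _ a4 _ _ _
  (edge t0 (refl , refl) , edge t1 (refl , refl) , edge t2 (a-closes , refl) ,
   edge t3 (refl , refl) , edge t4 (refl , b-closes) , edge t5 (refl , refl)) v2-in =
  (n ∸ (b0 + (a4 + (2 + k))) , b0 , a4 , k , t1 , t3 , t5) ,
  ∈-placements⁺ (ℕ.m∸n+n≡m (subst (_≤ n) (v2-sum a4 b0 t5 t0 t1) v2-in)) (∈-shapes⁺ k (closing-shape t0 t1 t2 t3 t4 t5 A B)) ,
  cong₂ (λ A B → (a4 + suc t5 , b0) ∷ (A , b0) ∷ (A , b0 + suc t1) ∷ (a4 + suc t3 , B) ∷ (a4 , B) ∷ (a4 , b0 + suc t5) ∷ [])
        (trans (cong (λ t → a4 + t) (proj₁ (closing-sides t0 t1 t2 t3 t5 A))) (sym (ℕ.+-assoc a4 (suc t5) (suc t0))))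
        (trans (cong (λ t → b0 + t) (proj₂ (closing-sides t0 t1 t2 t3 t5 A))) (sym (ℕ.+-assoc b0 (suc t1) (suc t2))))
  where
  k : ℕ
  k = suc (t5 + t0 + t1)
  A : t5 + t0 ≡ t3 + t2
  A = cancel-steps a4 t5 t0 t3 t2 a-closes
  B : t1 + t2 ≡ t5 + t4
  B = cancel-steps b0 t1 t2 t5 t4 b-closes
  v2-sum : ∀ a b t5 t0 t1 → a + suc t5 + suc t0 + (b + suc t1) ≡ b + (a + (2 + suc (t5 + t0 + t1)))
  v2-sum = solve-∀

vertex : Fin 6 → Hexagon → Point
vertex i v = lookup v i

cut≤ : ∀ {k x y z} → (x , y , z) ∈ shapes k → x ≤ suc k
cut≤ {k} s∈ = ℕ.m≤n⇒m≤1+n (ℕ.<⇒≤ (summand₁< (proj₂ (proj₂ (∈-shapes⁻ k s∈)))))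

-- Distinct placements have distinct canonical labellings: v₄, v₀, v₂, v₃ and v₁ determine
-- p, q, z, x, y and k in turn, and r is then fixed by the triangle.
corners-injective : ∀ n {pl pl′} → pl ∈ placements n → pl′ ∈ placements n → corners pl ≡ corners pl′ → pl ≡ pl′
corners-injective n {r , q , p , k , x , y , z} {r′ , q′ , p′ , k′ , x′ , y′ , z′} pl∈ pl′∈ e
  with cong (proj₁ ∘ vertex (# 4)) e | cong (proj₂ ∘ vertex (# 0)) e
... | refl | refl
  with ℕ.+-cancelˡ-≡ p _ _ (cong (proj₁ ∘ vertex (# 0)) e) | ℕ.+-cancelˡ-≡ q _ _ (cong (proj₂ ∘ vertex (# 2)) e)
     | ℕ.+-cancelˡ-≡ p _ _ (cong (proj₁ ∘ vertex (# 3)) e)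
... | refl | refl | refl
  with ∈-placements⁻ n pl∈ | ∈-placements⁻ n pl′∈
... | total≡n , s∈ | total′≡n , s′∈
  with ℕ.suc-injective (trans (sym (ℕ.m∸n+n≡m (cut≤ s∈)))
         (trans (cong (_+ x) (ℕ.+-cancelˡ-≡ p _ _ (cong (proj₁ ∘ vertex (# 1)) e))) (ℕ.m∸n+n≡m (cut≤ s′∈))))
... | refl = cong (_, q , p , k , x , y , z) (ℕ.+-cancelʳ-≡ _ r r′ (trans total≡n (sym total′≡n)))

-- Labellings.  The labelling of (d , pl) starts at the vertex of the canonical labelling of pl from
-- which the side of direction d leaves, i.e. it is shifted by offset d.
offset : Dir → ℕ
offset D0 = 0
offset D1 = 1
offset D2 = 2
offset D3 = 3
offset D4 = 4
offset D5 = 5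

offsets : ∀ d → rotate (offset d) D0 ≡ d × rotate (6 ∸ offset d) d ≡ D0 × offset d + (6 ∸ offset d) ≡ 6
offsets D0 = refl , refl , refl
offsets D1 = refl , refl , refl
offsets D2 = refl , refl , refl
offsets D3 = refl , refl , refl
offsets D4 = refl , refl , refl
offsets D5 = refl , refl , refl

-- shifting six times is the identity, so every shift is invertible
shifts-+ : ∀ i j v → shifts (i + j) v ≡ shifts i (shifts j v)
shifts-+ zero    j v = refl
shifts-+ (suc i) j v = cong shift (shifts-+ i j v)

shifts-6 : ∀ v → shifts 6 v ≡ v
shifts-6 (_ ∷ _ ∷ _ ∷ _ ∷ _ ∷ _ ∷ []) = refl

shift-injective : ∀ v w → shift v ≡ shift w → v ≡ w
shift-injective (_ ∷ _ ∷ _ ∷ _ ∷ _ ∷ _ ∷ []) (_ ∷ _ ∷ _ ∷ _ ∷ _ ∷ _ ∷ []) e = cong (shifts 5) e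

shifts-injective : ∀ i {v w} → shifts i v ≡ shifts i w → v ≡ w
shifts-injective zero    e = e
shifts-injective (suc i) {v} {w} e = shifts-injective i (shift-injective (shifts i v) (shifts i w) e)

shifts-All : ∀ {P : Point → Set} i v → VecAll.All P v → VecAll.All P (shifts i v)
shifts-All zero    v all = all
shifts-All (suc i) v all = shift-All (shifts i v) (shifts-All i v all)
  where
  shift-All : ∀ v → VecAll.All _ v → VecAll.All _ (shift v)
  shift-All (_ ∷ _ ∷ _ ∷ _ ∷ _ ∷ _ ∷ []) (p0 VecAll.∷ p1 VecAll.∷ p2 VecAll.∷ p3 VecAll.∷ p4 VecAll.∷ p5 VecAll.∷ VecAll.[]) =
    p1 VecAll.∷ p2 VecAll.∷ p3 VecAll.∷ p4 VecAll.∷ p5 VecAll.∷ p0 VecAll.∷ VecAll.[]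

unshift : ∀ d v → Regular d v → Regular D0 (shifts (6 ∸ offset d) v) × shifts (offset d) (shifts (6 ∸ offset d) v) ≡ v
unshift d v r =
  subst (λ d′ → Regular d′ (shifts (6 ∸ offset d) v)) (proj₁ (proj₂ (offsets d))) (regular-shifts (6 ∸ offset d) d v r) ,
  trans (sym (shifts-+ (offset d) (6 ∸ offset d) v)) (trans (cong (λ i → shifts i v) (proj₂ (proj₂ (offsets d)))) (shifts-6 v))

first-edge : ∀ d v → Regular d v → Edge d (vertex (# 0) v) (vertex (# 1) v)
first-edge d (_ ∷ _ ∷ _ ∷ _ ∷ _ ∷ _ ∷ []) r = proj₁ r

allDirs : List Dir
allDirs = D0 ∷ D1 ∷ D2 ∷ D3 ∷ D4 ∷ D5 ∷ []

∈-allDirs : ∀ d → d ∈ allDirs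
∈-allDirs D0 = here refl
∈-allDirs D1 = there (here refl)
∈-allDirs D2 = there (there (here refl))
∈-allDirs D3 = there (there (there (here refl)))
∈-allDirs D4 = there (there (there (there (here refl))))
∈-allDirs D5 = there (there (there (there (there (here refl)))))

allDirs-unique : Unique allDirs
allDirs-unique = ((λ ()) All.∷ (λ ()) All.∷ (λ ()) All.∷ (λ ()) All.∷ (λ ()) All.∷ All.[])
               ∷ ((λ ()) All.∷ (λ ()) All.∷ (λ ()) All.∷ (λ ()) All.∷ All.[])
               ∷ ((λ ()) All.∷ (λ ()) All.∷ (λ ()) All.∷ All.[])
               ∷ ((λ ()) All.∷ (λ ()) All.∷ All.[])
               ∷ ((λ ()) All.∷ All.[])
               ∷ All.[]
               ∷ []

labelling : Dir × Placement → Hexagon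
labelling (d , pl) = shifts (offset d) (corners pl)

labellings : ℕ → List Hexagon
labellings n = map labelling (cartesianProduct allDirs (placements n))

corners-regular : ∀ n pl → pl ∈ placements n → Regular D0 (corners pl)
corners-regular n (r , q , p , k , x , y , z) pl∈ =
  placement-regular r q p k x y z (∈-shapes⁻ k (proj₂ (∈-placements⁻ n pl∈)))

labelling-regular : ∀ n d pl → pl ∈ placements n → Regular d (labelling (d , pl))
labelling-regular n d pl pl∈ =
  subst (λ d′ → Regular d′ (labelling (d , pl))) (proj₁ (offsets d)) (regular-shifts (offset d) D0 (corners pl) (corners-regular n pl pl∈))

-- the vertices of a placement lie in the triangle: v₂ is on the side a + b = p + q + k + 2 ≤ n
corners-inTriangle : ∀ n pl → pl ∈ placements n → VecAll.All (InTriangle n) (corners pl)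
corners-inTriangle n pl@(r , q , p , k , x , y , z) pl∈ =
  regular-inTriangle n _ _ _ _ _ _ (corners-regular n pl pl∈) (subst (_≤ n) (sym v2-sum) (subst (_ ≤_) total≡n (ℕ.m≤n+m _ r)))
  where
  total≡n : r + (q + (p + (2 + k))) ≡ n
  total≡n = proj₁ (∈-placements⁻ n pl∈)
  v2-sum : p + (suc k ∸ x) + (q + suc x) ≡ q + (p + (2 + k))
  v2-sum = trans (regroup p q (suc k ∸ x) x) (cong (λ s → q + (p + suc s)) (ℕ.m∸n+n≡m (cut≤ (proj₂ (∈-placements⁻ n pl∈)))))
    where
    regroup : ∀ p q a x → p + a + (q + suc x) ≡ q + (p + suc (a + x))
    regroup = solve-∀

canonical-hexagon : ∀ n w → Regular D0 w → VecAll.All (InTriangle n) w → Σ Placement λ pl → pl ∈ placements n × corners pl ≡ w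
canonical-hexagon n ((a0 , b0) ∷ (a1 , b1) ∷ (a2 , b2) ∷ (a3 , b3) ∷ (a4 , b4) ∷ (a5 , b5) ∷ []) r (_ VecAll.∷ _ VecAll.∷ v2-in VecAll.∷ _) =
  canonical n a0 b0 a1 b1 a2 b2 a3 b3 a4 b4 a5 b5 r v2-in

∈-labellings⁻ : ∀ n {v} → v ∈ labellings n → T (isNetHexagon v) × VecAll.All (InTriangle n) v
∈-labellings⁻ n v∈ =
  let (d , pl) , dp∈ , v≡ = ∈-map⁻ labelling v∈
      pl∈ = proj₂ (∈-cartesianProduct⁻ allDirs (placements n) dp∈)
  in subst (λ v → T (isNetHexagon v) × VecAll.All (InTriangle n) v) (sym v≡)
       ( regular⇒hexagon d _ (labelling-regular n d pl pl∈)
       , shifts-All (offset d) (corners pl) (corners-inTriangle n pl pl∈))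

∈-labellings⁺ : ∀ n v → T (isNetHexagon v) → VecAll.All (InTriangle n) v → v ∈ labellings n
∈-labellings⁺ n v hex inside =
  let d , r = hexagon⇒regular v hex
      r₀ , restore = unshift d v r
      pl , pl∈ , corners≡ = canonical-hexagon n _ r₀ (shifts-All (6 ∸ offset d) v inside)
  in subst (_∈ labellings n) (trans (cong (shifts (offset d)) corners≡) restore)
       (∈-map⁺ labelling (∈-cartesianProduct⁺ (∈-allDirs d) pl∈))

-- equal labellings have the same first side, hence the same direction and then the same placement
labelling-injective : ∀ n {dp dp′} → dp ∈ cartesianProduct allDirs (placements n) → dp′ ∈ cartesianProduct allDirs (placements n) →
                      labelling dp ≡ labelling dp′ → dp ≡ dp′
labelling-injective n {d , pl} {d′ , pl′} dp∈ dp′∈ e = same (edge-direction first first′) e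
  where
  pl∈ = proj₂ (∈-cartesianProduct⁻ allDirs (placements n) dp∈)
  pl′∈ = proj₂ (∈-cartesianProduct⁻ allDirs (placements n) dp′∈)
  first : Edge d (vertex (# 0) (labelling (d , pl))) (vertex (# 1) (labelling (d , pl)))
  first = first-edge d _ (labelling-regular n d pl pl∈)
  first′ : Edge d′ (vertex (# 0) (labelling (d , pl))) (vertex (# 1) (labelling (d , pl)))
  first′ = subst (λ v → Edge d′ (vertex (# 0) v) (vertex (# 1) v)) (sym e) (first-edge d′ _ (labelling-regular n d′ pl′ pl′∈))
  same : d ≡ d′ → labelling (d , pl) ≡ labelling (d′ , pl′) → (d , pl) ≡ (d′ , pl′)
  same refl e = cong (d ,_) (corners-injective n pl∈ pl′∈ (shifts-injective (offset d) e))

netRow : ℕ → ℕ → List Point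
netRow n a = map (a ,_) (upTo (suc (n ∸ a)))

∈-netPoints⁻ : ∀ n {a b} → (a , b) ∈ netPoints n → a + b ≤ n
∈-netPoints⁻ n p∈ = in-row (find (∈-concatMap⁻ (netRow n) {xs = upTo (suc n)} p∈))
  where
  in-row : ∀ {a b} → (Σ ℕ λ a′ → a′ ∈ upTo (suc n) × (a , b) ∈ netRow n a′) → a + b ≤ n
  in-row {a} (a′ , a′∈ , p∈row) with ∈-map⁻ (a′ ,_) p∈row
  ... | _ , b∈ , refl = ℕ.≤-trans (ℕ.+-monoʳ-≤ a (ℕ.≤-pred (∈-upTo⁻ b∈))) (ℕ.≤-reflexive (ℕ.m+[n∸m]≡n (ℕ.≤-pred (∈-upTo⁻ a′∈))))

∈-netPoints⁺ : ∀ n {a b} → a + b ≤ n → (a , b) ∈ netPoints n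
∈-netPoints⁺ n {a} {b} a+b≤n =
  ∈-concatMap⁺ (netRow n) {xs = upTo (suc n)}
    (lose (∈-upTo⁺ (s≤s (ℕ.≤-trans (ℕ.m≤m+n a b) a+b≤n)))
          (∈-map⁺ (a ,_) (∈-upTo⁺ (s≤s (subst (_≤ n ∸ a) (ℕ.m+n∸m≡n a b) (ℕ.∸-monoˡ-≤ a a+b≤n))))))

netPoints-unique : ∀ n → Unique (netPoints n)
netPoints-unique n =
  concatMap-unique (netRow n) (Unique.upTo⁺ (suc n)) (λ a → Unique.map⁺ (λ { refl → refl }) (Unique.upTo⁺ (suc (n ∸ a))))
    (λ {a} {a′} a≢a′ (p∈ , p∈′) → a≢a′ (trans (sym (cong proj₁ (proj₂ (proj₂ (∈-map⁻ (a ,_) p∈)))))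
                                               (cong proj₁ (proj₂ (proj₂ (∈-map⁻ (a′ ,_) p∈′))))))

∈-tuples⁻ : ∀ {A : Set} k (xs : List A) {v} → v ∈ tuples k xs → VecAll.All (_∈ xs) v
∈-tuples⁻ zero    xs {[]} _  = VecAll.[]
∈-tuples⁻ (suc k) xs     v∈ = extend (find (∈-concatMap⁻ (λ y → map (y ∷_) (tuples k xs)) {xs = xs} v∈))
  where
  extend : ∀ {v} → (Σ _ λ y → y ∈ xs × v ∈ map (y ∷_) (tuples k xs)) → VecAll.All (_∈ xs) v
  extend (y , y∈ , v∈′) with ∈-map⁻ (y ∷_) v∈′
  ... | _ , w∈ , refl = y∈ VecAll.∷ ∈-tuples⁻ k xs w∈

∈-tuples⁺ : ∀ {A : Set} k (xs : List A) {v} → VecAll.All (_∈ xs) v → v ∈ tuples k xs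
∈-tuples⁺ zero    xs {[]}    _              = here refl
∈-tuples⁺ (suc k) xs {x ∷ v} (x∈ VecAll.∷ v∈) =
  ∈-concatMap⁺ (λ y → map (y ∷_) (tuples k xs)) {xs = xs} (lose x∈ (∈-map⁺ (x ∷_) (∈-tuples⁺ k xs v∈)))

tuples-unique : ∀ {A : Set} k (xs : List A) → Unique xs → Unique (tuples k xs)
tuples-unique zero    xs _   = All.[] ∷ []
tuples-unique (suc k) xs uxs =
  concatMap-unique (λ y → map (y ∷_) (tuples k xs)) uxs (λ y → Unique.map⁺ ∷-injectiveʳ (tuples-unique k xs uxs))
    (λ {y} {y′} y≢y′ (v∈ , v∈′) → y≢y′ (∷-injectiveˡ (trans (sym (proj₂ (proj₂ (∈-map⁻ (y ∷_) v∈))))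
                                                           (proj₂ (proj₂ (∈-map⁻ (y′ ∷_) v∈′))))))

labellings-unique : ∀ n → Unique (labellings n)
labellings-unique n =
  map-unique labelling (Unique.cartesianProduct⁺ allDirs-unique (placements-unique n)) (labelling-injective n)

hexLabellings-count : ∀ n → hexLabellings n ≡ 6 * length (placements n)
hexLabellings-count n = begin
  hexLabellings n                                   ≡⟨ same-length candidates-unique (labellings-unique n) (mk⇔ to from) ⟩
  length (labellings n)                             ≡⟨ length-map labelling (cartesianProduct allDirs (placements n)) ⟩
  length (cartesianProduct allDirs (placements n))  ≡⟨ length-cartesianProduct allDirs (placements n) ⟩
  6 * length (placements n)                         ∎
  where
  open ≡-Reasoning
  hexagon? : Decidable (λ v → T (isNetHexagon v))
  hexagon? v = T? (isNetHexagon v)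
  candidates-unique : Unique (filter hexagon? (tuples 6 (netPoints n)))
  candidates-unique = Unique.filter⁺ hexagon? (tuples-unique 6 (netPoints n) (netPoints-unique n))
  to : ∀ {v} → v ∈ filter hexagon? (tuples 6 (netPoints n)) → v ∈ labellings n
  to {v} v∈ = let v∈tuples , hex = ∈-filter⁻ hexagon? {xs = tuples 6 (netPoints n)} v∈
              in ∈-labellings⁺ n v hex (VecAll.map (∈-netPoints⁻ n) (∈-tuples⁻ 6 (netPoints n) v∈tuples))
  from : ∀ {v} → v ∈ labellings n → v ∈ filter hexagon? (tuples 6 (netPoints n))
  from v∈ = let hex , inside = ∈-labellings⁻ n v∈
            in ∈-filter⁺ hexagon? (∈-tuples⁺ 6 (netPoints n) (VecAll.map (∈-netPoints⁺ n) inside)) hex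

hexagon-count : ∀ n → H n ≡ length (placements n)
hexagon-count n = trans (cong (_/ 6) (trans (hexLabellings-count n) (ℕ.*-comm 6 (length (placements n)))))
                        (m*n/n≡m (length (placements n)) 6)

theorem3p1 : (k : ℕ)
    → (60 * H (2 * k + 1) + (3 * k ^ 2 + 4 * k)
         ≡ 8 * k ^ 6 + 24 * k ^ 5 + 25 * k ^ 4 + 10 * k ^ 3)
    × (60 * H (2 * suc k) + (5 * suc k ^ 4 + 3 * suc k ^ 2) ≡ 8 * suc k ^ 6)
theorem3p1 k = odd (H (2 * k + 1)) (hexagon-count (2 * k + 1)) , even (H (2 * suc k)) (hexagon-count (2 * suc k))
  where
  -- h stands for H(…), passed explicitly: H is computable, and unifying it against arithmetic
  -- expressions would make the type checker start evaluating it by brute force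
  odd : ∀ h → h ≡ length (placements (2 * k + 1)) →
        60 * h + (3 * k ^ 2 + 4 * k) ≡ 8 * k ^ 6 + 24 * k ^ 5 + 25 * k ^ 4 + 10 * k ^ 3
  odd _ refl = subst (λ n → 60 * length (placements n) + (3 * k ^ 2 + 4 * k) ≡ 8 * k ^ 6 + 24 * k ^ 5 + 25 * k ^ 4 + 10 * k ^ 3)
                     (ℕ.+-comm 1 (2 * k)) (placements-odd k)
  even : ∀ h → h ≡ length (placements (2 * suc k)) → 60 * h + (5 * suc k ^ 4 + 3 * suc k ^ 2) ≡ 8 * suc k ^ 6
  even _ refl = placements-even k
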